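{- Let $G$ be the run graph of a tredoku tiling $T$ with $\tau$ tiles and $\rho$ runs. Then (a) $T$ has no leaves if and only if $G$ is a cubic ($3$-regular) graph; (b) $\tau=2\rho+1$ if and only if $G$ is a tree.
   Context: A tile is a closed rhombus of unit side with interior angles $60^\circ$ and $120^\circ$, placed so that its edges lie on a fixed triangular lattice of the plane. Two tiles are adjacent if they share a full common edge. A run is a maximal sequence $T_1,\dots,T_k$ ($k\ge 2$) of distinct tiles such that $T_i$ and $T_{i+1}$ share an edge $e_i$, all the $e_i$ are parallel, and for $1<i<k$ the edges $e_{i-1},e_i$ are opposite edges of $T_i$. A tredoku tiling is a finite set of $\tau\ge5$ tiles such that: (P1) the adjacency graph on the tiles is connected; (P2) any two tiles are disjoint, meet in exactly one common vertex, or share a full common edge; (P3) after removing any single tile, the remaining tiles are still connected, where two tiles are considered joined if they have nonempty intersection; (P4/P5) every run consists of exactly three tiles; and (no holes) the complement of the union of the tiles is connected. A leaf is a tile lying in exactly one run. The run graph of the tiling is the simple graph whose vertices are the runs, with an edge joining two distinct runs whenever they have a tile in common. -}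

module Defs where

open import Data.Nat using (ℕ; _≤_; _*_; _+_)
open import Data.Integer using (ℤ; +_; -[1+_]) renaming (_+_ to _+ℤ_)
open import Data.Fin using (Fin; zero; suc)
open import Data.Product using (Σ; ∃; ∃-syntax; _×_; _,_; proj₁; proj₂)
open import Data.Sum using (_⊎_)
open import Data.List using (List; []; _∷_; _++_; [_]; _∷ʳ_; reverse; length; concatMap)
open import Data.List.Membership.Propositional using (_∈_)
open import Data.List.Relation.Unary.All using (All)
open import Data.List.Relation.Unary.Linked using (Linked)
open import Data.List.Relation.Unary.Unique.Propositional using (Unique)
open import Relation.Binary.PropositionalEquality using (_≡_; _≢_)
open import Relation.Binary.Construct.Closure.ReflexiveTransitive using (Star)
open import Relation.Nullary using (¬_)

-- A lattice point (a , b) stands for a·u + b·v with u = (1,0),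
-- v = (1/2, √3/2).

Point : Set
Point = ℤ × ℤ

_⊕_ : Point → Point → Point
(a , b) ⊕ (c , d) = (a +ℤ c , b +ℤ d)

Dir : Set
Dir = Fin 3

dvec : Dir → Point
dvec zero             = (+ 1 , + 0)
dvec (suc zero)       = (+ 0 , + 1)
dvec (suc (suc zero)) = (-[1+ 0 ] , + 1)

d0 d1 d2 : Point
d0 = dvec zero
d1 = dvec (suc zero)
d2 = dvec (suc (suc zero))

minus-d0 : Point
minus-d0 = (-[1+ 0 ] , + 0)

-- A lattice edge (p , k): the unit segment from p to p ⊕ dvec k.
-- Every lattice edge has exactly one such representation.
Edge : Set
Edge = Point × Dir

edgeDir : Edge → Dir
edgeDir = proj₂

-- Cells of the triangulation of the plane by the lattice.
-- up p   = triangle with vertices p, p⊕d0, p⊕d1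
-- down p = triangle with vertices p⊕d0, p⊕d1, p⊕d0⊕d1
data Cell : Set where
  vtx  : Point → Cell
  edg  : Edge → Cell
  up   : Point → Cell
  down : Point → Cell

faces : Cell → List Cell
faces (vtx p) = []
faces (edg (p , k)) = vtx p ∷ vtx (p ⊕ dvec k) ∷ []
faces (up p) =
  vtx p ∷ vtx (p ⊕ d0) ∷ vtx (p ⊕ d1) ∷
  edg (p , zero) ∷ edg (p , suc zero) ∷ edg (p ⊕ d0 , suc (suc zero)) ∷ []
faces (down p) =
  vtx (p ⊕ d0) ∷ vtx (p ⊕ d1) ∷ vtx ((p ⊕ d0) ⊕ d1) ∷
  edg (p ⊕ d0 , suc (suc zero)) ∷ edg (p ⊕ d1 , zero) ∷ edg (p ⊕ d0 , suc zero) ∷ []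

closure : Cell → List Cell
closure c = c ∷ faces c

-- Tiles: 60/120 rhombi of unit side with edges on the lattice.
-- A tile (p , o) has side directions (a o , b o) and vertices
-- p, p ⊕ a, p ⊕ b, p ⊕ a ⊕ b.
-- Every such rhombus has exactly one representation.

Tile : Set
Tile = Point × Fin 3

sa sb : Fin 3 → Dir
sa zero             = zero
sa (suc zero)       = suc zero
sa (suc (suc zero)) = zero
sb zero             = suc zero
sb (suc zero)       = suc (suc zero)
sb (suc (suc zero)) = suc (suc zero)

sideA₁ sideA₂ sideB₁ sideB₂ : Tile → Edge
sideA₁ (p , o) = (p , sa o)
sideA₂ (p , o) = (p ⊕ dvec (sb o) , sa o)
sideB₁ (p , o) = (p , sb o)
sideB₂ (p , o) = (p ⊕ dvec (sa o) , sb o)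

sides : Tile → List Edge
sides t = sideA₁ t ∷ sideA₂ t ∷ sideB₁ t ∷ sideB₂ t ∷ []

oppositePairs : Tile → List (Edge × Edge)
oppositePairs t =
  (sideA₁ t , sideA₂ t) ∷ (sideA₂ t , sideA₁ t) ∷
  (sideB₁ t , sideB₂ t) ∷ (sideB₂ t , sideB₁ t) ∷ []

Opposite : Tile → Edge → Edge → Set
Opposite t e e' = (e , e') ∈ oppositePairs t

triangles : Tile → List Cell
triangles (p , zero)             = up p ∷ down p ∷ []
triangles (p , suc zero)         = down (p ⊕ minus-d0) ∷ up (p ⊕ d2) ∷ []
triangles (p , suc (suc zero))   = up p ∷ down (p ⊕ minus-d0) ∷ []

-- The closed tile as a (closed) subcomplex: its cells.
-- The closed rhombus, as a point set, is the disjoint union of the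
-- relative interiors of these cells.
cells : Tile → List Cell
cells t = concatMap closure (triangles t)

Common : Tile → Tile → Cell → Set
Common A B c = (c ∈ cells A) × (c ∈ cells B)

Meets : Tile → Tile → Set
Meets A B = ∃[ c ] Common A B c

Adjacent : Tile → Tile → Set
Adjacent A B = (A ≢ B) × (∃[ e ] ((e ∈ sides A) × (e ∈ sides B)))

ConnectedOn : {A : Set} → (A → Set) → (A → A → Set) → Set
ConnectedOn {A} P R =
  ∀ (x y : A) → P x → P y → Star (λ u v → P u × P v × R u v) x y

P1 : List Tile → Set
P1 T = ConnectedOn (_∈ T) Adjacent

P2 : List Tile → Set
P2 T = ∀ A B → A ∈ T → B ∈ T → A ≢ B →
    (∀ c → ¬ Common A B c)
  ⊎ (∃[ v ] (∀ c → (Common A B c → c ≡ vtx v) × (c ≡ vtx v → Common A B c)))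
  ⊎ (∃[ e ] ((e ∈ sides A) × (e ∈ sides B) ×
       (∀ c → (Common A B c → c ∈ closure (edg e)) × (c ∈ closure (edg e) → Common A B c))))

P3 : List Tile → Set
P3 T = ∀ t → t ∈ T → ConnectedOn (λ x → (x ∈ T) × (x ≢ t)) Meets

Covered : List Tile → Cell → Set
Covered T c = ∃[ t ] ((t ∈ T) × (c ∈ cells t))

FaceRel : Cell → Cell → Set
FaceRel c c' = (c ∈ faces c') ⊎ (c' ∈ faces c)

-- complement of the union is connected: the complement is the union of the
-- open cells not covered, and two such open cells touch iff one is a face of
-- the other.
NoHoles : List Tile → Set
NoHoles T = ConnectedOn (λ c → ¬ Covered T c) FaceRel

-- ChainFrom t e us : we entered tile t through its edge e, and the
-- sequence continues with tiles us; each further shared edge is opposite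
-- to the previous one in the current tile (hence parallel to it).
data ChainFrom (t : Tile) (e : Edge) : List Tile → Set where
  end  : ChainFrom t e []
  step : ∀ {u us} (e' : Edge) → Opposite t e e' → e' ∈ sides u →
         edgeDir e ≡ edgeDir e' → ChainFrom u e' us → ChainFrom t e (u ∷ us)

data RunSeq : List Tile → Set where
  start : ∀ {t₁ t₂ rest} (e : Edge) → e ∈ sides t₁ → e ∈ sides t₂ →
          ChainFrom t₂ e rest → RunSeq (t₁ ∷ t₂ ∷ rest)

SeqIn : List Tile → List Tile → Set
SeqIn T ts = All (_∈ T) ts × Unique ts × RunSeq ts

IsRun : List Tile → List Tile → Set
IsRun T ts = SeqIn T ts × (∀ t → ¬ SeqIn T (t ∷ ts)) × (∀ t → ¬ SeqIn T (ts ∷ʳ t))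

SameRun : List Tile → List Tile → Set
SameRun r r' = (r ≡ r') ⊎ (r ≡ reverse r')

P45 : List Tile → Set
P45 T = ∀ r → IsRun T r → length r ≡ 3

Tredoku : List Tile → Set
Tredoku T = Unique T × (5 ≤ length T) × P1 T × P2 T × P3 T × P45 T × NoHoles T

IsLeaf : List Tile → Tile → Set
IsLeaf T t = ∃[ r ] (IsRun T r × (t ∈ r) × (∀ r' → IsRun T r' → t ∈ r' → SameRun r' r))

-- Rs : Fin ρ → List Tile enumerates the runs of T, each exactly once
-- (up to reversal); ρ is then the number of runs.
RunEnumeration : List Tile → (ρ : ℕ) → (Fin ρ → List Tile) → Set
RunEnumeration T ρ Rs =
    (∀ i → IsRun T (Rs i))
  × (∀ r → IsRun T r → ∃[ i ] SameRun r (Rs i))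
  × (∀ i j → SameRun (Rs i) (Rs j) → i ≡ j)

RunGraph : {ρ : ℕ} → (Fin ρ → List Tile) → Fin ρ → Fin ρ → Set
RunGraph Rs i j = (i ≢ j) × (∃[ t ] ((t ∈ Rs i) × (t ∈ Rs j)))

Cubic : (n : ℕ) → (Fin n → Fin n → Set) → Set
Cubic n E = ∀ i → ∃[ j₁ ] ∃[ j₂ ] ∃[ j₃ ]
  ((j₁ ≢ j₂) × (j₁ ≢ j₃) × (j₂ ≢ j₃) × E i j₁ × E i j₂ × E i j₃ ×
   (∀ j → E i j → (j ≡ j₁) ⊎ (j ≡ j₂) ⊎ (j ≡ j₃)))

GraphConnected : (n : ℕ) → (Fin n → Fin n → Set) → Set
GraphConnected n E = ∀ i j → Star E i j

HasCycle : (n : ℕ) → (Fin n → Fin n → Set) → Set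
HasCycle n E = ∃[ x ] ∃[ xs ] ((2 ≤ length xs) × Unique (x ∷ xs) × Linked E ((x ∷ xs) ++ [ x ]))

IsTree : (n : ℕ) → (Fin n → Fin n → Set) → Set
IsTree n E = GraphConnected n E × ¬ HasCycle n E

{-# OPTIONS --safe #-}
module Submission where

open import Defs
open import Data.Nat using (ℕ; _*_; _+_)
open import Data.Fin using (Fin)
open import Data.Product using (_×_; _,_)
open import Data.List using (List; length)
open import Data.List.Membership.Propositional using (_∈_)
open import Relation.Binary.PropositionalEquality using (_≡_)
open import Relation.Nullary using (¬_)
open import Function using (_⇔_)

-- Every run has three tiles, and the run through a tile crossing it in a given direction
-- is unique: across each side a tile has at most one neighbour, and the end of a run has
-- none beyond it.  A tile has two side directions, so it lies in one or two runs; and two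
-- distinct runs share at most one tile.  The configurations of rhombi behind these facts
-- are finitely many up to translation and are checked by evaluation.
--
-- (a) A run whose three tiles each lie in a second run has three distinct neighbours, and
-- conversely three neighbours leave no tile of the run to be a leaf.
-- (b) Counting run–tile incidences gives |E| + τ = 3ρ for the run graph, which is
-- connected by (P1); a connected simple graph on ρ vertices is a tree iff it has ρ − 1
-- edges.  Only (P1), (P2) and (P4/P5) are used, not (P3) or the absence of holes.

module Lists where

  open import Data.Nat using (ℕ; suc; _+_; _*_; _≤_; z≤n; s≤s)
  open import Data.Nat.Properties using (+-commutativeSemigroup)
  open import Algebra.Properties.CommutativeSemigroup +-commutativeSemigroup using (interchange)
  open import Data.List using (List; []; _∷_; length; filter; concatMap)
  open import Data.List.Properties using (length-++; length-removeAt′)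
  open import Data.List.Membership.Propositional using (_∈_; _─_; find)
  open import Data.List.Membership.Propositional.Properties using (∈-concatMap⁻)
  open import Data.List.Relation.Unary.AllPairs using (AllPairs; []; _∷_)
  import Data.List.Relation.Unary.AllPairs.Properties as AllPairs
  open import Data.List.Relation.Unary.Any using (here; there; toSum)
  open import Data.List.Relation.Unary.All using (All; []; _∷_)
  import Data.List.Relation.Unary.All as All
  open import Data.List.Relation.Unary.Unique.Propositional using (Unique)
  open import Data.Empty using (⊥-elim)
  open import Data.Product using (_,_)
  open import Data.Sum using (_⊎_; inj₁; inj₂; [_,_])
  open import Function using (_∘_)
  open import Relation.Binary using (DecidableEquality)
  open import Relation.Binary.PropositionalEquality hiding ([_])
  open import Relation.Nullary using (Dec; yes; no; ¬_)

  𝟙 : {P : Set} → Dec P → ℕ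
  𝟙 (yes _) = 1
  𝟙 (no _)  = 0

  module _ {P : Set} where

    𝟙-yes : (d : Dec P) → P → 𝟙 d ≡ 1
    𝟙-yes (yes _) _ = refl
    𝟙-yes (no ¬p) p = ⊥-elim (¬p p)

    𝟙-no : (d : Dec P) → ¬ P → 𝟙 d ≡ 0
    𝟙-no (yes p) ¬p = ⊥-elim (¬p p)
    𝟙-no (no _)  _  = refl

    𝟙-cong : {Q : Set} (d : Dec P) (d′ : Dec Q) → (P → Q) → (Q → P) → 𝟙 d ≡ 𝟙 d′
    𝟙-cong (yes _) (yes _)  _ _ = refl
    𝟙-cong (yes p) (no ¬q)  f _ = ⊥-elim (¬q (f p))
    𝟙-cong (no ¬p) (yes q)  _ g = ⊥-elim (¬p (g q))
    𝟙-cong (no _)  (no _)   _ _ = refl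

    𝟙-+ : {Q R : Set} (d : Dec R) (dp : Dec P) (dq : Dec Q) →
          (R → P ⊎ Q) → (P → R) → (Q → R) → (P → ¬ Q) → 𝟙 d ≡ 𝟙 dp + 𝟙 dq
    𝟙-+ (yes r) (yes p) (yes q) _    _  _  p⇒¬q = ⊥-elim (p⇒¬q p q)
    𝟙-+ (yes r) (yes p) (no _)  _    _  _  _    = refl
    𝟙-+ (yes r) (no _)  (yes q) _    _  _  _    = refl
    𝟙-+ (yes r) (no ¬p) (no ¬q) r⇒pq _  _  _    = ⊥-elim ([ ¬p , ¬q ] (r⇒pq r))
    𝟙-+ (no ¬r) (yes p) _       _    pr _  _    = ⊥-elim (¬r (pr p))
    𝟙-+ (no ¬r) (no _)  (yes q) _    _  qr _    = ⊥-elim (¬r (qr q))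
    𝟙-+ (no _)  (no _)  (no _)  _    _  _  _    = refl

  module _ {A : Set} where

    ∑ : List A → (A → ℕ) → ℕ
    ∑ []       f = 0
    ∑ (x ∷ xs) f = f x + ∑ xs f

    ∑-cong : ∀ xs {f g : A → ℕ} → (∀ x → x ∈ xs → f x ≡ g x) → ∑ xs f ≡ ∑ xs g
    ∑-cong []       _   = refl
    ∑-cong (x ∷ xs) f≡g = cong₂ _+_ (f≡g x (here refl)) (∑-cong xs (λ y y∈xs → f≡g y (there y∈xs)))

    ∑-distrib-+ : ∀ xs (f g : A → ℕ) → ∑ xs (λ x → f x + g x) ≡ ∑ xs f + ∑ xs g
    ∑-distrib-+ []       f g = refl
    ∑-distrib-+ (x ∷ xs) f g = begin
        f x + g x + ∑ xs (λ y → f y + g y)   ≡⟨ cong (f x + g x +_) (∑-distrib-+ xs f g) ⟩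
        f x + g x + (∑ xs f + ∑ xs g)        ≡⟨ interchange (f x) (g x) (∑ xs f) (∑ xs g) ⟩
        f x + ∑ xs f + (g x + ∑ xs g)        ∎
      where open ≡-Reasoning

    ∑-const : ∀ xs c → ∑ xs (λ _ → c) ≡ length xs * c
    ∑-const []       c = refl
    ∑-const (x ∷ xs) c = cong (c +_) (∑-const xs c)

    ∑-zero : ∀ xs → ∑ xs (λ _ → 0) ≡ 0
    ∑-zero []       = refl
    ∑-zero (x ∷ xs) = ∑-zero xs

    length-filter≡∑𝟙 : {P : A → Set} (P? : ∀ x → Dec (P x)) (xs : List A) →
                       length (filter P? xs) ≡ ∑ xs (λ x → 𝟙 (P? x))
    length-filter≡∑𝟙 P? []       = refl
    length-filter≡∑𝟙 P? (x ∷ xs) with P? x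
    ... | yes _ = cong suc (length-filter≡∑𝟙 P? xs)
    ... | no _  = length-filter≡∑𝟙 P? xs

    module _ (_≟_ : DecidableEquality A) where

      open import Data.List.Membership.DecPropositional _≟_ using (_∈?_)

      ∑𝟙-≟ : ∀ {xs c} → Unique xs → c ∈ xs → ∑ xs (λ x → 𝟙 (x ≟ c)) ≡ 1
      ∑𝟙-≟ {x ∷ xs} {c} (x∉xs ∷ u) c∈ with x ≟ c | c∈
      ... | yes refl | _          =
        cong suc (trans (∑-cong xs λ y y∈xs → 𝟙-no (y ≟ c) λ y≡c → All.lookup x∉xs y∈xs (sym y≡c)) (∑-zero xs))
      ... | no x≢c   | here c≡x   = ⊥-elim (x≢c (sym c≡x))
      ... | no _     | there c∈xs = ∑𝟙-≟ u c∈xs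

      ∑𝟙-∈? : ∀ {xs ys} → Unique xs → Unique ys → All (_∈ xs) ys → ∑ xs (λ x → 𝟙 (x ∈? ys)) ≡ length ys
      ∑𝟙-∈? {xs} {[]}     _   _            _               =
        trans (∑-cong xs (λ x _ → 𝟙-no (x ∈? []) λ ())) (∑-zero xs)
      ∑𝟙-∈? {xs} {y ∷ ys} uxs (y∉ys ∷ uys) (y∈xs ∷ ys⊆xs) = begin
          ∑ xs (λ x → 𝟙 (x ∈? y ∷ ys))              ≡⟨ ∑-cong xs (λ x _ → split x) ⟩
          ∑ xs (λ x → 𝟙 (x ≟ y) + 𝟙 (x ∈? ys))      ≡⟨ ∑-distrib-+ xs _ _ ⟩
          ∑ xs (λ x → 𝟙 (x ≟ y)) + ∑ xs (λ x → 𝟙 (x ∈? ys))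
                                                   ≡⟨ cong₂ _+_ (∑𝟙-≟ uxs y∈xs) (∑𝟙-∈? uxs uys ys⊆xs) ⟩
          suc (length ys)                          ∎
        where
          open ≡-Reasoning
          split : ∀ x → 𝟙 (x ∈? y ∷ ys) ≡ 𝟙 (x ≟ y) + 𝟙 (x ∈? ys)
          split x = 𝟙-+ (x ∈? y ∷ ys) (x ≟ y) (x ∈? ys) toSum here there
                        (λ { refl x∈ys → All.lookup y∉ys x∈ys refl })

  module _ {A B : Set} where

    ∑-swap : ∀ (xs : List A) (ys : List B) (f : A → B → ℕ) →
             ∑ xs (λ x → ∑ ys (f x)) ≡ ∑ ys (λ y → ∑ xs (λ x → f x y))
    ∑-swap []       ys f = sym (∑-zero ys)
    ∑-swap (x ∷ xs) ys f = trans (cong (∑ ys (f x) +_) (∑-swap xs ys f))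
                                 (sym (∑-distrib-+ ys (f x) (λ y → ∑ xs (λ x′ → f x′ y))))

    length-concatMap≡∑ : (f : A → List B) (xs : List A) → length (concatMap f xs) ≡ ∑ xs (λ x → length (f x))
    length-concatMap≡∑ f []       = refl
    length-concatMap≡∑ f (x ∷ xs) = trans (length-++ (f x)) (cong (length (f x) +_) (length-concatMap≡∑ f xs))

  module _ {A : Set} where

    ∈-─ : ∀ {xs : List A} {x y} → y ∈ xs → (x∈xs : x ∈ xs) → y ≢ x → y ∈ xs ─ x∈xs
    ∈-─ (here refl)  (here refl)  y≢x = ⊥-elim (y≢x refl)
    ∈-─ (there y∈xs) (here refl)  _   = y∈xs
    ∈-─ (here y≡z)   (there x∈xs) _   = here y≡z
    ∈-─ (there y∈xs) (there x∈xs) y≢x = there (∈-─ y∈xs x∈xs y≢x)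

    Unique-length-≤ : ∀ {xs ys : List A} → Unique ys → All (_∈ xs) ys → length ys ≤ length xs
    Unique-length-≤         []             []             = z≤n
    Unique-length-≤ {xs} {y ∷ ys} (y∉ys ∷ u) (y∈xs ∷ ys⊆xs) =
      subst (suc (length ys) ≤_) (sym (length-removeAt′ xs _))
        (s≤s (Unique-length-≤ u (All.zipWith (λ (y′∈xs , y≢y′) → ∈-─ y′∈xs y∈xs (y≢y′ ∘ sym)) (ys⊆xs , y∉ys))))

  data OneOrTwo {A : Set} : List A → Set where
    one : ∀ a → OneOrTwo (a ∷ [])
    two : ∀ a b → OneOrTwo (a ∷ b ∷ [])

  one-or-two : ∀ {A : Set} {x : A} (xs : List A) → x ∈ xs → Unique xs →
               (∀ {a b c} → a ∈ xs → b ∈ xs → c ∈ xs → a ≡ b ⊎ a ≡ c ⊎ b ≡ c) → OneOrTwo xs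
  one-or-two (a ∷ [])          _ _ _ = one a
  one-or-two (a ∷ b ∷ [])      _ _ _ = two a b
  one-or-two (a ∷ b ∷ c ∷ _) _ ((a≢b ∷ a≢c ∷ _) ∷ (b≢c ∷ _) ∷ _) two-values
    with two-values (here refl) (there (here refl)) (there (there (here refl)))
  ... | inj₁ a≡b        = ⊥-elim (a≢b a≡b)
  ... | inj₂ (inj₁ a≡c) = ⊥-elim (a≢c a≡c)
  ... | inj₂ (inj₂ b≡c) = ⊥-elim (b≢c b≡c)

  AllPairs-concatMap : ∀ {A B : Set} {R : B → B → Set} (f : A → List B) {xs} → Unique xs →
    (∀ x → AllPairs R (f x)) → (∀ {x x′ p q} → x ≢ x′ → p ∈ f x → q ∈ f x′ → R p q) → AllPairs R (concatMap f xs)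
  AllPairs-concatMap f []               _      _     = []
  AllPairs-concatMap f (x∉xs ∷ unique) within across =
    AllPairs.++⁺ (within _) (AllPairs-concatMap f unique within across)
      (All.tabulate λ p∈ → All.tabulate λ q∈ →
        let (x′ , x′∈xs , q∈f) = find (∈-concatMap⁻ f q∈) in across (All.lookup x∉xs x′∈xs) p∈ q∈f)

module EdgeLists where

  open Lists
  open import Data.Nat using (ℕ; suc; _+_; _*_; _≤_; z≤n; s≤s)
  open import Data.Nat.Properties using (+-suc; +-comm; *-identityʳ; ≤-trans; n≤1+n; 1+n≰n)
  open import Data.Fin using (Fin; _≟_)
  open import Data.Product using (∃-syntax; _×_; _,_; proj₁; proj₂)
  open import Data.Sum using (_⊎_; inj₁; inj₂)
  import Data.Sum
  open import Data.Empty using (⊥; ⊥-elim)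
  open import Data.Maybe using (just)
  open import Data.Maybe.Relation.Binary.Connected using (Connected; just)
  open import Data.List using (List; []; _∷_; _++_; [_]; length; allFin; last)
  open import Data.List.Properties using (length-removeAt′; length-tabulate)
  open import Data.List.Membership.Propositional using (_∈_; _─_)
  open import Data.List.Membership.Propositional.Properties using (∈-allFin; ∈-++⁺ʳ)
  open import Data.List.Relation.Unary.Any using (here; there)
  open import Data.List.Relation.Unary.All using (All; []; _∷_)
  import Data.List.Relation.Unary.All as All
  open import Data.List.Relation.Unary.All.Properties.Core using (¬Any⇒All¬)
  open import Data.List.Relation.Unary.AllPairs using (AllPairs; []; _∷_)
  open import Data.List.Relation.Unary.Linked using (Linked; []; [-]; _∷_)
  import Data.List.Relation.Unary.Linked as Linked
  import Data.List.Relation.Unary.Linked.Properties as Linked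
  open import Data.List.Relation.Unary.Unique.Propositional using (Unique)
  open import Data.List.Relation.Unary.Unique.Propositional.Properties using (allFin⁺)
  open import Function using (_⇔_; mk⇔; _∘_)
  open import Relation.Binary.Construct.Closure.ReflexiveTransitive using (Star; ε; _◅_; _◅◅_)
  import Relation.Binary.Construct.Closure.ReflexiveTransitive as Star
  open import Relation.Binary.PropositionalEquality hiding ([_])
  open import Relation.Binary.PropositionalEquality.Core using (≢-sym)
  open import Relation.Nullary using (Dec; yes; no; ¬_)
  open import Relation.Nullary.Decidable using (_×-dec_; _⊎-dec_)

  module _ {n : ℕ} where

    open import Data.List.Membership.DecPropositional (_≟_ {n}) using (_∈?_)

    Pair : Set
    Pair = Fin n × Fin n

    Joins : List Pair → Fin n → Fin n → Set
    Joins L a b = ((a , b) ∈ L) ⊎ ((b , a) ∈ L)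

    Reachable : List Pair → Fin n → Fin n → Set
    Reachable L = Star (Joins L)

    Joins-sym : ∀ {L a b} → Joins L a b → Joins L b a
    Joins-sym (inj₁ ab∈L) = inj₂ ab∈L
    Joins-sym (inj₂ ba∈L) = inj₁ ba∈L

    Joins-∷ : ∀ {L p a b} → Joins L a b → Joins (p ∷ L) a b
    Joins-∷ (inj₁ ab∈L) = inj₁ (there ab∈L)
    Joins-∷ (inj₂ ba∈L) = inj₂ (there ba∈L)

    Reachable-sym : ∀ {L a b} → Reachable L a b → Reachable L b a
    Reachable-sym = Star.reverse Joins-sym

    Reachable-∷ : ∀ {L p a b} → Reachable L a b → Reachable (p ∷ L) a b
    Reachable-∷ = Star.map Joins-∷

    SameEdge : Pair → Pair → Set
    SameEdge (a , b) (c , d) = (a ≡ c × b ≡ d) ⊎ (a ≡ d × b ≡ c)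

    SameEdge-swap : ∀ {a b q} → SameEdge (b , a) q → SameEdge (a , b) q
    SameEdge-swap (inj₁ (b≡ , a≡)) = inj₂ (a≡ , b≡)
    SameEdge-swap (inj₂ (b≡ , a≡)) = inj₁ (a≡ , b≡)

    SameEdge? : ∀ p q → Dec (SameEdge p q)
    SameEdge? (a , b) (c , d) = ((a ≟ c) ×-dec (b ≟ d)) ⊎-dec ((a ≟ d) ×-dec (b ≟ c))

    Simple : List Pair → Set
    Simple L = All (λ (a , b) → a ≢ b) L × AllPairs (λ p q → ¬ SameEdge p q) L

    RedundantEdge : List Pair → Set
    RedundantEdge L = ∃[ Ps ] ∃[ u ] ∃[ v ] ∃[ Qs ] ((L ≡ Ps ++ (u , v) ∷ Qs) × Reachable Qs u v)

    #roots : (Fin n → Fin n) → ℕ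
    #roots f = ∑ (allFin n) (λ v → 𝟙 (f v ≟ v))

    -- Union–find run over L from its last entry to its first: `merges` counts the
    -- entries that joined two different classes.
    record Components (L : List Pair) : Set where
      field
        root                    : Fin n → Fin n
        root-idem               : ∀ v → root (root v) ≡ root v
        same-root⇒reachable     : ∀ {a b} → root a ≡ root b → Reachable L a b
        joins⇒same-root         : ∀ {a b} → Joins L a b → root a ≡ root b
        merges                  : ℕ
        #roots+merges           : #roots root + merges ≡ n
        merges≤length           : merges ≤ length L
        merges≡length⊎redundant : merges ≡ length L ⊎ RedundantEdge L

      reachable⇒same-root : ∀ {a b} → Reachable L a b → root a ≡ root b
      reachable⇒same-root ε         = refl
      reachable⇒same-root (j ◅ js) = trans (joins⇒same-root j) (reachable⇒same-root js)

    open Components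

    discrete : Components []
    discrete = record
      { root = λ v → v ; root-idem = λ _ → refl ; same-root⇒reachable = λ { refl → ε }
      ; joins⇒same-root = λ { (inj₁ ()) ; (inj₂ ()) } ; merges = 0
      ; #roots+merges = trans (+-comm _ 0) all-roots
      ; merges≤length = z≤n ; merges≡length⊎redundant = inj₁ refl }
      where
        all-roots : #roots (λ v → v) ≡ n
        all-roots = begin
          ∑ (allFin n) (λ v → 𝟙 (v ≟ v))  ≡⟨ ∑-cong (allFin n) (λ v _ → 𝟙-yes (v ≟ v) refl) ⟩
          ∑ (allFin n) (λ _ → 1)          ≡⟨ ∑-const (allFin n) 1 ⟩
          length (allFin n) * 1           ≡⟨ *-identityʳ (length (allFin n)) ⟩
          length (allFin n)               ≡⟨ length-tabulate (λ i → i) ⟩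
          n                               ∎
          where open ≡-Reasoning

    module _ {L : List Pair} {u v : Fin n} (C : Components L) where

      add-internal : root C u ≡ root C v → Components ((u , v) ∷ L)
      add-internal same = record
        { root = root C ; root-idem = root-idem C ; same-root⇒reachable = λ r → Reachable-∷ (same-root⇒reachable C r)
        ; joins⇒same-root = joins ; merges = merges C ; #roots+merges = #roots+merges C
        ; merges≤length = ≤-trans (merges≤length C) (n≤1+n _)
        ; merges≡length⊎redundant = inj₂ ([] , u , v , L , refl , same-root⇒reachable C same) }
        where
          joins : ∀ {a b} → Joins ((u , v) ∷ L) a b → root C a ≡ root C b
          joins (inj₁ (here refl)) = same
          joins (inj₂ (here refl)) = sym same
          joins (inj₁ (there m))   = joins⇒same-root C (inj₁ m)
          joins (inj₂ (there m))   = joins⇒same-root C (inj₂ m)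

      module AddBridge (distinct : root C u ≢ root C v) where

        redirect : Fin n → Fin n
        redirect c with c ≟ root C v
        ... | yes _ = root C u
        ... | no _  = c

        redirect-≡ : ∀ {c} → c ≡ root C v → redirect c ≡ root C u
        redirect-≡ {c} c≡ with c ≟ root C v
        ... | yes _  = refl
        ... | no c≢ = ⊥-elim (c≢ c≡)

        redirect-≢ : ∀ {c} → c ≢ root C v → redirect c ≡ c
        redirect-≢ {c} c≢ with c ≟ root C v
        ... | yes c≡ = ⊥-elim (c≢ c≡)
        ... | no _   = refl

        root′ : Fin n → Fin n
        root′ w = redirect (root C w)

        root′-idem : ∀ w → root′ (root′ w) ≡ root′ w
        root′-idem w = by-cases (root C w ≟ root C v)
          where
            open ≡-Reasoning
            by-cases : Dec (root C w ≡ root C v) → root′ (root′ w) ≡ root′ w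
            by-cases (yes w~v) = begin
              redirect (root C (redirect (root C w))) ≡⟨ cong (redirect ∘ root C) (redirect-≡ w~v) ⟩
              redirect (root C (root C u))            ≡⟨ cong redirect (root-idem C u) ⟩
              redirect (root C u)                     ≡⟨ redirect-≢ distinct ⟩
              root C u                                ≡⟨ redirect-≡ w~v ⟨
              redirect (root C w)                     ∎
            by-cases (no w≁v) = begin
              redirect (root C (redirect (root C w))) ≡⟨ cong (redirect ∘ root C) (redirect-≢ w≁v) ⟩
              redirect (root C (root C w))            ≡⟨ cong redirect (root-idem C w) ⟩
              redirect (root C w)                     ∎

        new-edge : Reachable ((u , v) ∷ L) u v
        new-edge = inj₁ (here refl) ◅ ε

        joins⇒same-root′ : ∀ {a b} → Joins ((u , v) ∷ L) a b → root′ a ≡ root′ b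
        joins⇒same-root′ (inj₁ (here refl)) = trans (redirect-≢ distinct) (sym (redirect-≡ refl))
        joins⇒same-root′ (inj₂ (here refl)) = trans (redirect-≡ refl) (sym (redirect-≢ distinct))
        joins⇒same-root′ (inj₁ (there m))   = cong redirect (joins⇒same-root C (inj₁ m))
        joins⇒same-root′ (inj₂ (there m))   = cong redirect (joins⇒same-root C (inj₂ m))

        same-root′⇒reachable : ∀ {a b} → root′ a ≡ root′ b → Reachable ((u , v) ∷ L) a b
        same-root′⇒reachable {a} {b} a~b = by-cases (root C a ≟ root C v) (root C b ≟ root C v)
          where
            old : ∀ {x y} → root C x ≡ root C y → Reachable ((u , v) ∷ L) x y
            old = Reachable-∷ ∘ same-root⇒reachable C
            by-cases : Dec (root C a ≡ root C v) → Dec (root C b ≡ root C v) → Reachable ((u , v) ∷ L) a b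
            by-cases (yes a~v) (yes b~v) = old (trans a~v (sym b~v))
            by-cases (yes a~v) (no b≁v)  =
              old a~v ◅◅ Reachable-sym new-edge ◅◅ old (trans (sym (redirect-≡ a~v)) (trans a~b (redirect-≢ b≁v)))
            by-cases (no a≁v)  (yes b~v) =
              old (trans (sym (redirect-≢ a≁v)) (trans a~b (redirect-≡ b~v))) ◅◅ new-edge ◅◅ old (sym b~v)
            by-cases (no a≁v)  (no b≁v)  = old (trans (sym (redirect-≢ a≁v)) (trans a~b (redirect-≢ b≁v)))

        -- The root of v's class is the one root that disappears.
        lost-root : ∀ w → 𝟙 (root′ w ≟ w) + 𝟙 (w ≟ root C v) ≡ 𝟙 (root C w ≟ w)
        lost-root w = by-cases (root C w ≟ root C v)
          where
            open ≡-Reasoning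
            root-v : w ≡ root C v → root C w ≡ root C v
            root-v w≡ = trans (cong (root C) w≡) (root-idem C v)
            by-cases : Dec (root C w ≡ root C v) → 𝟙 (root′ w ≟ w) + 𝟙 (w ≟ root C v) ≡ 𝟙 (root C w ≟ w)
            by-cases (yes w~v) = cong₂ _+_ (𝟙-no (root′ w ≟ w) not-root)
                                           (𝟙-cong (w ≟ root C v) (root C w ≟ w)
                                              (λ w≡ → trans (root-v w≡) (sym w≡)) (λ w-root → trans (sym w-root) w~v))
              where
                not-root : root′ w ≢ w
                not-root w-root = distinct (begin
                  root C u                 ≡⟨ root-idem C u ⟨
                  root C (root C u)        ≡⟨ cong (root C) (trans (sym (redirect-≡ w~v)) w-root) ⟩
                  root C w                 ≡⟨ w~v ⟩
                  root C v                 ∎)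
            by-cases (no w≁v) = begin
              𝟙 (root′ w ≟ w) + 𝟙 (w ≟ root C v)  ≡⟨ cong₂ _+_ (𝟙-cong (root′ w ≟ w) (root C w ≟ w)
                                                        (trans (sym (redirect-≢ w≁v))) (trans (redirect-≢ w≁v)))
                                                     (𝟙-no (w ≟ root C v) (w≁v ∘ root-v)) ⟩
              𝟙 (root C w ≟ w) + 0                ≡⟨ +-comm _ 0 ⟩
              𝟙 (root C w ≟ w)                    ∎

        #roots′ : #roots root′ + 1 ≡ #roots (root C)
        #roots′ = begin
          #roots root′ + 1
            ≡⟨ cong (#roots root′ +_) (∑𝟙-≟ _≟_ (allFin⁺ n) (∈-allFin (root C v))) ⟨
          #roots root′ + ∑ (allFin n) (λ w → 𝟙 (w ≟ root C v))
            ≡⟨ ∑-distrib-+ (allFin n) _ _ ⟨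
          ∑ (allFin n) (λ w → 𝟙 (root′ w ≟ w) + 𝟙 (w ≟ root C v))
            ≡⟨ ∑-cong (allFin n) (λ w _ → lost-root w) ⟩
          #roots (root C) ∎
          where open ≡-Reasoning

        add-bridge : Components ((u , v) ∷ L)
        add-bridge = record
          { root = root′ ; root-idem = root′-idem
          ; same-root⇒reachable = same-root′⇒reachable ; joins⇒same-root = joins⇒same-root′
          ; merges = suc (merges C)
          ; #roots+merges =
              trans (+-suc _ (merges C)) (trans (cong (_+ merges C) (trans (+-comm 1 _) #roots′)) (#roots+merges C))
          ; merges≤length = s≤s (merges≤length C)
          ; merges≡length⊎redundant = Data.Sum.map (cong suc) extend (merges≡length⊎redundant C) }
          where
            extend : RedundantEdge L → RedundantEdge ((u , v) ∷ L)
            extend (Ps , a , b , Qs , L≡ , r) = (u , v) ∷ Ps , a , b , Qs , cong ((u , v) ∷_) L≡ , r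

    components : ∀ L → Components L
    components []            = discrete
    components ((u , v) ∷ L) with components L
    ... | C with root C u ≟ root C v
    ... | yes same     = add-internal C same
    ... | no distinct = AddBridge.add-bridge C distinct

    module _ {L : List Pair} (connected : ∀ x y → Reachable L x y) (v₀ : Fin n) where

      connected⇒#roots≡1 : (C : Components L) → #roots (root C) ≡ 1
      connected⇒#roots≡1 C = trans
        (∑-cong (allFin n) λ w _ → 𝟙-cong (root C w ≟ w) (w ≟ root C v₀)
           (λ w-root → trans (sym w-root) (reachable⇒same-root C (connected w v₀))) (λ { refl → root-idem C v₀ }))
        (∑𝟙-≟ _≟_ (allFin⁺ n) (∈-allFin (root C v₀)))

      connected⇒suc-merges≡n : (C : Components L) → suc (merges C) ≡ n
      connected⇒suc-merges≡n C = trans (cong (_+ merges C) (sym (connected⇒#roots≡1 C))) (#roots+merges C)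

      connected⇒≤suc-length : n ≤ suc (length L)
      connected⇒≤suc-length =
        subst (_≤ suc (length L)) (connected⇒suc-merges≡n C) (s≤s (merges≤length C))
        where C = components L

      connected-irredundant⇒suc-length≡n : ¬ RedundantEdge L → suc (length L) ≡ n
      connected-irredundant⇒suc-length≡n irredundant with merges≡length⊎redundant (components L)
      ... | inj₁ merges≡ = trans (cong suc (sym merges≡)) (connected⇒suc-merges≡n (components L))
      ... | inj₂ redundant = ⊥-elim (irredundant redundant)

    SimplePath : (Fin n → Fin n → Set) → Fin n → Fin n → Set
    SimplePath R a b = ∃[ p ] (Unique (a ∷ p) × Linked R (a ∷ p) × last (a ∷ p) ≡ just b)

    module _ {R : Fin n → Fin n → Set} where

      suffix-path : ∀ {a b} xs → a ∈ xs → Unique xs → Linked R xs → last xs ≡ just b → SimplePath R a b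
      suffix-path (_ ∷ p)     (here refl) unique       linked       last≡ = p , unique , linked , last≡
      suffix-path (_ ∷ _ ∷ _) (there a∈)  (_ ∷ unique) (_ ∷ linked) last≡ = suffix-path _ a∈ unique linked last≡

      Star⇒SimplePath : ∀ {a b} → Star R a b → SimplePath R a b
      Star⇒SimplePath ε = [] , [] ∷ [] , [-] , refl
      Star⇒SimplePath {a} (r ◅ rs) with Star⇒SimplePath rs
      ... | p , unique , linked , last≡ with a ∈? (_ ∷ p)
      ... | yes a∈ = suffix-path (_ ∷ p) a∈ unique linked last≡
      ... | no a∉  = _ ∷ p , ¬Any⇒All¬ _ a∉ ∷ unique , r ∷ linked , last≡

    AllPairs-middle : ∀ {R : Pair → Pair → Set} Ps {x Qs} → AllPairs R (Ps ++ x ∷ Qs) → All (R x) Qs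
    AllPairs-middle []       (x~Qs ∷ _) = x~Qs
    AllPairs-middle (_ ∷ Ps) (_ ∷ rest) = AllPairs-middle Ps rest

    redundant⇒cycle : ∀ {L} → Simple L → RedundantEdge L → HasCycle n (Joins L)
    redundant⇒cycle (loopless , distinct) (Ps , u , v , Qs , refl , u⇝v) with Star⇒SimplePath u⇝v
    ... | []          , _      , _      , refl  = ⊥-elim (All.lookup loopless (∈-++⁺ʳ Ps (here refl)) refl)
    ... | _ ∷ []      , _      , j ∷ [-] , refl = ⊥-elim (repeated j)
      where
        repeated : Joins Qs u v → ⊥
        repeated (inj₁ m) = All.lookup (AllPairs-middle Ps distinct) m (inj₁ (refl , refl))
        repeated (inj₂ m) = All.lookup (AllPairs-middle Ps distinct) m (inj₂ (refl , refl))
    ... | w₁ ∷ w₂ ∷ p , unique , linked , last≡ =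
      u , w₁ ∷ w₂ ∷ p , s≤s (s≤s z≤n) , unique ,
      Linked.++⁺ (Linked.map widen linked) (subst (λ m → Connected (Joins L) m (just u)) (sym last≡) (just closing)) [-]
      where
        L = Ps ++ (u , v) ∷ Qs
        widen : ∀ {a b} → Joins Qs a b → Joins L a b
        widen (inj₁ m) = inj₁ (∈-++⁺ʳ Ps (there m))
        widen (inj₂ m) = inj₂ (∈-++⁺ʳ Ps (there m))
        closing : Joins L v u
        closing = inj₂ (∈-++⁺ʳ Ps (here refl))

    Joins-entry : ∀ {L x y} → Joins L x y → ∃[ π ] (π ∈ L × (∀ {q} → ¬ SameEdge q (x , y) → q ≢ π))
    Joins-entry (inj₁ m) = _ , m , λ { ¬same refl → ¬same (inj₁ (refl , refl)) }
    Joins-entry (inj₂ m) = _ , m , λ { ¬same refl → ¬same (inj₂ (refl , refl)) }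

    Joins-─ : ∀ {L x y π} (π∈L : π ∈ L) → (∀ {q} → ¬ SameEdge q (x , y) → q ≢ π) →
              ∀ {a b} → Joins L a b → ¬ SameEdge (a , b) (x , y) → Joins (L ─ π∈L) a b
    Joins-─ π∈L other (inj₁ m) ¬same = inj₁ (∈-─ m π∈L (other ¬same))
    Joins-─ π∈L other (inj₂ m) ¬same = inj₂ (∈-─ m π∈L (other (¬same ∘ SameEdge-swap)))

    cycle⇒removable-edge : ∀ {L} → HasCycle n (Joins L) →
      ∃[ L′ ] (length L ≡ suc (length L′) × (∀ {a b} → Joins L a b → Reachable L′ a b))
    cycle⇒removable-edge (_ , _ ∷ [] , s≤s () , _)
    cycle⇒removable-edge {L} (x , x₁ ∷ r ∷ rest , _ , (x∉ ∷ x₁∉ ∷ _) , (jx ∷ j₁ ∷ linked)) =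
      L ─ π∈L , length-removeAt′ L _ , reroute
      where
        Avoids : Fin n → Set
        Avoids z = z ≢ x × z ≢ x₁

        source-avoids : ∀ {a b} → Avoids a → ¬ SameEdge (a , b) (x , x₁)
        source-avoids (a≢x , _)  (inj₁ (a≡x , _))  = a≢x a≡x
        source-avoids (_ , a≢x₁) (inj₂ (a≡x₁ , _)) = a≢x₁ a≡x₁

        target-avoids : ∀ {a b} → Avoids b → ¬ SameEdge (a , b) (x , x₁)
        target-avoids (_ , b≢x₁) (inj₁ (_ , b≡x₁)) = b≢x₁ b≡x₁
        target-avoids (b≢x , _)  (inj₂ (_ , b≡x))  = b≢x b≡x

        π∈L = proj₁ (proj₂ (Joins-entry jx))

        keep : ∀ {a b} → Joins L a b → ¬ SameEdge (a , b) (x , x₁) → Joins (L ─ π∈L) a b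
        keep = Joins-─ π∈L (proj₂ (proj₂ (Joins-entry jx)))

        through : ∀ y ys → Linked (Joins L) (y ∷ ys ++ [ x ]) → All Avoids (y ∷ ys) → Reachable (L ─ π∈L) y x
        through y []       (j ∷ [-])    (ay ∷ []) = keep j (source-avoids ay) ◅ ε
        through y (z ∷ zs) (j ∷ linked) (ay ∷ as) = keep j (source-avoids ay) ◅ through z zs linked as

        -- The rest of the cycle, x₁ → r → … → x, avoids the edge x x₁.
        detour : Reachable (L ─ π∈L) x₁ x
        detour = keep j₁ (target-avoids (All.head avoiders)) ◅ through r rest linked avoiders
          where
            avoiders : All Avoids (r ∷ rest)
            avoiders = All.zipWith (λ (x≢ , x₁≢) → ≢-sym x≢ , ≢-sym x₁≢) (All.tail x∉ , x₁∉)

        reroute : ∀ {a b} → Joins L a b → Reachable (L ─ π∈L) a b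
        reroute {a} {b} j with SameEdge? (a , b) (x , x₁)
        ... | yes (inj₁ (refl , refl)) = Reachable-sym detour
        ... | yes (inj₂ (refl , refl)) = detour
        ... | no ¬same                 = keep j ¬same ◅ ε

    module _ {R : Fin n → Fin n → Set} {L : List Pair}
             (R⇒Joins : ∀ {a b} → R a b → Joins L a b) (Joins⇒R : ∀ {a b} → Joins L a b → R a b)
             (simple : Simple L) (connected : GraphConnected n R) (v₀ : Fin n) where

      acyclic⇔suc-length≡n : (¬ HasCycle n R) ⇔ (suc (length L) ≡ n)
      acyclic⇔suc-length≡n = mk⇔ acyclic⇒count count⇒acyclic
        where
          reachable : ∀ x y → Reachable L x y
          reachable x y = Star.map R⇒Joins (connected x y)

          acyclic⇒count : ¬ HasCycle n R → suc (length L) ≡ n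
          acyclic⇒count acyclic = connected-irredundant⇒suc-length≡n reachable v₀ λ redundant →
            let (x , xs , long , unique , linked) = redundant⇒cycle simple redundant
            in acyclic (x , xs , long , unique , Linked.map Joins⇒R linked)

          count⇒acyclic : suc (length L) ≡ n → ¬ HasCycle n R
          count⇒acyclic count (x , xs , long , unique , linked) =
            let (L′ , length≡ , reroute) = cycle⇒removable-edge (x , xs , long , unique , Linked.map R⇒Joins linked)
                n≤ = connected⇒≤suc-length (λ a b → Star.concat (Star.map reroute (reachable a b))) v₀
            in 1+n≰n (subst₂ _≤_ (sym count) (sym length≡) n≤)

module Lattice where

  open import Data.Integer using (+_) renaming (-_ to -ℤ_)
  import Data.Integer as ℤ
  import Data.Integer.Properties as ℤ
  open import Data.Nat using (ℕ)
  open import Data.Fin using (Fin; zero; suc)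
  import Data.Fin.Properties as Fin
  open import Data.Product using (∃-syntax; _×_; _,_; proj₁; proj₂)
  import Data.Product.Properties as Product
  open import Data.Sum using (_⊎_)
  import Data.Sum
  open import Data.List using (List; []; _∷_; map)
  open import Data.List.Membership.Propositional using (_∈_; _∉_)
  import Data.List.Membership.Propositional as Membership
  open import Data.List.Membership.Propositional.Properties using (∈-map⁺)
  open import Data.List.Relation.Unary.Any using (here; there; any?)
  open import Data.List.Relation.Unary.All using (All; all?; lookup)
  open import Function using (_∘_)
  open import Relation.Binary using (DecidableEquality)
  open import Relation.Binary.PropositionalEquality
  open import Relation.Nullary using (Dec; ¬_; ¬?)
  open import Relation.Nullary.Decidable using (True; map′; toWitness; _×-dec_; _⊎-dec_; _→-dec_)

  origin : Point
  origin = (+ 0 , + 0)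

  negate : Point → Point
  negate (a , b) = (-ℤ a , -ℤ b)

  ⊕-assoc : ∀ p q r → (p ⊕ q) ⊕ r ≡ p ⊕ (q ⊕ r)
  ⊕-assoc (a , b) (c , d) (e , f) = cong₂ _,_ (ℤ.+-assoc a c e) (ℤ.+-assoc b d f)

  ⊕-comm : ∀ p q → p ⊕ q ≡ q ⊕ p
  ⊕-comm (a , b) (c , d) = cong₂ _,_ (ℤ.+-comm a c) (ℤ.+-comm b d)

  ⊕-identityʳ : ∀ p → p ⊕ origin ≡ p
  ⊕-identityʳ (a , b) = cong₂ _,_ (ℤ.+-identityʳ a) (ℤ.+-identityʳ b)

  ⊕-inverseʳ : ∀ p → p ⊕ negate p ≡ origin
  ⊕-inverseʳ (a , b) = cong₂ _,_ (ℤ.+-inverseʳ a) (ℤ.+-inverseʳ b)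

  ⊕-swap : ∀ p q r → (p ⊕ q) ⊕ r ≡ (p ⊕ r) ⊕ q
  ⊕-swap p q r = trans (⊕-assoc p q r) (trans (cong (p ⊕_) (⊕-comm q r)) (sym (⊕-assoc p r q)))

  ⊕-cancel : ∀ p q r → q ⊕ r ≡ origin → (p ⊕ q) ⊕ r ≡ p
  ⊕-cancel p q r q⊕r≡0 = trans (⊕-assoc p q r) (trans (cong (p ⊕_) q⊕r≡0) (⊕-identityʳ p))

  shiftE : Point → Edge → Edge
  shiftE q (p , k) = (p ⊕ q , k)

  shiftT : Point → Tile → Tile
  shiftT q (p , o) = (p ⊕ q , o)

  shiftC : Point → Cell → Cell
  shiftC q (vtx p)  = vtx (p ⊕ q)
  shiftC q (edg e)  = edg (shiftE q e)
  shiftC q (up p)   = up (p ⊕ q)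
  shiftC q (down p) = down (p ⊕ q)

  shiftE-inverse : ∀ q e → shiftE (negate q) (shiftE q e) ≡ e
  shiftE-inverse q (p , k) = cong (_, k) (⊕-cancel p q (negate q) (⊕-inverseʳ q))

  shiftT-inverse : ∀ q t → shiftT (negate q) (shiftT q t) ≡ t
  shiftT-inverse q (p , o) = cong (_, o) (⊕-cancel p q (negate q) (⊕-inverseʳ q))

  shiftE-injective : ∀ q {e e′} → shiftE q e ≡ shiftE q e′ → e ≡ e′
  shiftE-injective q {e} {e′} eq =
    trans (sym (shiftE-inverse q e)) (trans (cong (shiftE (negate q)) eq) (shiftE-inverse q e′))

  shiftT-injective : ∀ q {t t′} → shiftT q t ≡ shiftT q t′ → t ≡ t′
  shiftT-injective q {t} {t′} eq =
    trans (sym (shiftT-inverse q t)) (trans (cong (shiftT (negate q)) eq) (shiftT-inverse q t′))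

  sides-shift : ∀ q t → map (shiftE q) (sides t) ≡ sides (shiftT q t)
  sides-shift q (p , o) rewrite ⊕-swap p (dvec (sb o)) q | ⊕-swap p (dvec (sa o)) q = refl

  oppositePairs-shift : ∀ q t → map (λ (e , f) → shiftE q e , shiftE q f) (oppositePairs t) ≡ oppositePairs (shiftT q t)
  oppositePairs-shift q (p , o) rewrite ⊕-swap p (dvec (sb o)) q | ⊕-swap p (dvec (sa o)) q = refl

  triangles-shift : ∀ q t → map (shiftC q) (triangles t) ≡ triangles (shiftT q t)
  triangles-shift q (p , zero)          = refl
  triangles-shift q (p , suc zero)      rewrite ⊕-swap p minus-d0 q | ⊕-swap p d2 q = refl
  triangles-shift q (p , suc (suc zero)) rewrite ⊕-swap p minus-d0 q = refl

  ∈-sides-shift : ∀ q {e t} → e ∈ sides t → shiftE q e ∈ sides (shiftT q t)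
  ∈-sides-shift q {e} {t} e∈ = subst (shiftE q e ∈_) (sides-shift q t) (∈-map⁺ (shiftE q) e∈)

  Opposite-shift : ∀ q {t e f} → Opposite t e f → Opposite (shiftT q t) (shiftE q e) (shiftE q f)
  Opposite-shift q {t} {e} {f} op = subst ((shiftE q e , shiftE q f) ∈_) (oppositePairs-shift q t) (∈-map⁺ _ op)

  Opposite-unshift : ∀ q {t e f} → Opposite (shiftT q t) (shiftE q e) (shiftE q f) → Opposite t e f
  Opposite-unshift q {t} {e} {f} op =
    subst₂ (Opposite t) (shiftE-inverse q e) (shiftE-inverse q f)
      (subst (λ t′ → Opposite t′ _ _) (shiftT-inverse q t) (Opposite-shift (negate q) op))

  ∈-triangles-shift : ∀ q {c t} → c ∈ triangles t → shiftC q c ∈ triangles (shiftT q t)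
  ∈-triangles-shift q {c} {t} c∈ = subst (shiftC q c ∈_) (triangles-shift q t) (∈-map⁺ (shiftC q) c∈)

  Overlap : Tile → Tile → Set
  Overlap x y = ∃[ c ] (c ∈ triangles x × c ∈ triangles y)

  Overlap-unshift : ∀ q {x y} → Overlap (shiftT q x) (shiftT q y) → Overlap x y
  Overlap-unshift q {x} {y} (c , c∈x , c∈y) = shiftC (negate q) c ,
    subst (λ z → _ ∈ triangles z) (shiftT-inverse q x) (∈-triangles-shift (negate q) c∈x) ,
    subst (λ z → _ ∈ triangles z) (shiftT-inverse q y) (∈-triangles-shift (negate q) c∈y)

  Opposite⇒∈sides₁ : ∀ {t e f} → Opposite t e f → e ∈ sides t
  Opposite⇒∈sides₁ (here refl)                         = here refl
  Opposite⇒∈sides₁ (there (here refl))                 = there (here refl)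
  Opposite⇒∈sides₁ (there (there (here refl)))         = there (there (here refl))
  Opposite⇒∈sides₁ (there (there (there (here refl)))) = there (there (there (here refl)))

  Opposite⇒∈sides₂ : ∀ {t e f} → Opposite t e f → f ∈ sides t
  Opposite⇒∈sides₂ (here refl)                         = there (here refl)
  Opposite⇒∈sides₂ (there (here refl))                 = here refl
  Opposite⇒∈sides₂ (there (there (here refl)))         = there (there (there (here refl)))
  Opposite⇒∈sides₂ (there (there (there (here refl)))) = there (there (here refl))

  Opposite-sym : ∀ {t e f} → Opposite t e f → Opposite t f e
  Opposite-sym (here refl)                         = there (here refl)
  Opposite-sym (there (here refl))                 = here refl
  Opposite-sym (there (there (here refl)))         = there (there (there (here refl)))
  Opposite-sym (there (there (there (here refl)))) = there (there (here refl))

  Opposite⇒parallel : ∀ {t e f} → Opposite t e f → edgeDir e ≡ edgeDir f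
  Opposite⇒parallel (here refl)                         = refl
  Opposite⇒parallel (there (here refl))                 = refl
  Opposite⇒parallel (there (there (here refl)))         = refl
  Opposite⇒parallel (there (there (there (here refl)))) = refl

  Apart : Tile → Tile → Set
  Apart x y = x ≢ y × ¬ Overlap x y

  Apart-shift : ∀ q {x y} → Apart x y → Apart (shiftT q x) (shiftT q y)
  Apart-shift q (x≢y , ¬overlap) = x≢y ∘ shiftT-injective q , ¬overlap ∘ Overlap-unshift q

  infix 4 _≟_ _≟ᶜ_

  _≟_ : DecidableEquality (Point × Fin 3)
  _≟_ = Product.≡-dec (Product.≡-dec ℤ._≟_ ℤ._≟_) Fin._≟_

  private
    encode : Cell → ℕ × Edge
    encode (vtx p)  = 0 , p , zero
    encode (edg e)  = 1 , e
    encode (up p)   = 2 , p , zero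
    encode (down p) = 3 , p , zero

    decode : ℕ × Edge → Cell
    decode (0 , p , _) = vtx p
    decode (1 , e)     = edg e
    decode (2 , p , _) = up p
    decode (_ , p , _) = down p

    decode-encode : ∀ c → decode (encode c) ≡ c
    decode-encode (vtx _)  = refl
    decode-encode (edg _)  = refl
    decode-encode (up _)   = refl
    decode-encode (down _) = refl

  _≟ᶜ_ : DecidableEquality Cell
  c ≟ᶜ c′ = map′ (λ eq → trans (sym (decode-encode c)) (trans (cong decode eq) (decode-encode c′))) (cong encode)
                 (Product.≡-dec Data.Nat._≟_ _≟_ (encode c) (encode c′))

  open import Data.List.Membership.DecPropositional _≟_ public using () renaming (_∈?_ to _∈ₗ?_)
  open import Data.List.Membership.DecPropositional _≟ᶜ_ using () renaming (_∈?_ to _∈ᶜ?_)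
  open import Data.List.Membership.DecPropositional (Product.≡-dec _≟_ _≟_) using () renaming (_∈?_ to _∈²?_)

  Overlap? : ∀ x y → Dec (Overlap x y)
  Overlap? x y = map′ (λ a → let (c , c∈x , c∈y) = Membership.find a in c , c∈x , c∈y)
                      (λ (c , c∈x , c∈y) → Membership.lose c∈x c∈y)
                      (any? (_∈ᶜ? triangles y) (triangles x))

  Apart? : ∀ x y → Dec (Apart x y)
  Apart? x y = ¬? (x ≟ y) ×-dec ¬? (Overlap? x y)

  Opposite? : ∀ t e f → Dec (Opposite t e f)
  Opposite? t e f = (e , f) ∈²? oppositePairs t

  unshift : ∀ {o : Fin 3} r d → (r , o) ≡ ((r ⊕ d) ⊕ negate d , o)
  unshift {o} r d = cong (_, o) (sym (⊕-cancel r d (negate d) (⊕-inverseʳ d)))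

  tilesWithSide : Edge → List Tile
  tilesWithSide (q , zero) =
    (q , zero) ∷ (q ⊕ negate d1 , zero) ∷ (q , suc (suc zero)) ∷ (q ⊕ negate d2 , suc (suc zero)) ∷ []
  tilesWithSide (q , suc zero) =
    (q , zero) ∷ (q ⊕ negate d0 , zero) ∷ (q , suc zero) ∷ (q ⊕ negate d2 , suc zero) ∷ []
  tilesWithSide (q , suc (suc zero)) =
    (q , suc zero) ∷ (q ⊕ negate d1 , suc zero) ∷ (q , suc (suc zero)) ∷ (q ⊕ negate d0 , suc (suc zero)) ∷ []

  ∈-tilesWithSide : ∀ {e} y → e ∈ sides y → y ∈ tilesWithSide e
  ∈-tilesWithSide (r , zero) (here refl)                         = here refl
  ∈-tilesWithSide (r , zero) (there (here refl))                 = there (here (unshift r d1))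
  ∈-tilesWithSide (r , zero) (there (there (here refl)))         = here refl
  ∈-tilesWithSide (r , zero) (there (there (there (here refl)))) = there (here (unshift r d0))
  ∈-tilesWithSide (r , suc zero) (here refl)                         = there (there (here refl))
  ∈-tilesWithSide (r , suc zero) (there (here refl))                 = there (there (there (here (unshift r d2))))
  ∈-tilesWithSide (r , suc zero) (there (there (here refl)))         = here refl
  ∈-tilesWithSide (r , suc zero) (there (there (there (here refl)))) = there (here (unshift r d1))
  ∈-tilesWithSide (r , suc (suc zero)) (here refl)                         = there (there (here refl))
  ∈-tilesWithSide (r , suc (suc zero)) (there (here refl))                 = there (there (there (here (unshift r d2))))
  ∈-tilesWithSide (r , suc (suc zero)) (there (there (here refl)))         = there (there (here refl))
  ∈-tilesWithSide (r , suc (suc zero)) (there (there (there (here refl)))) = there (there (there (here (unshift r d0))))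

  -- Each configuration below is decided by evaluation for the three tiles based at
  -- the origin, the candidate neighbours being enumerated by tilesWithSide; it then
  -- holds everywhere by translation.
  infixl 9 _!_
  _!_ : ∀ {A : Set} {P : A → Set} {xs x} → All P xs → x ∈ xs → P x
  all ! x∈xs = lookup all x∈xs

  orientations : List (Fin 3)
  orientations = zero ∷ suc zero ∷ suc (suc zero) ∷ []

  ∈-orientations : ∀ o → o ∈ orientations
  ∈-orientations zero             = here refl
  ∈-orientations (suc zero)       = there (here refl)
  ∈-orientations (suc (suc zero)) = there (there (here refl))

  at-origin : {P : Tile → Set} (P? : ∀ x → Dec (P x)) →
              {True (all? (λ o → P? (origin , o)) orientations)} → ∀ x → proj₁ x ≡ origin → P x
  at-origin P? {ok} (_ , o) refl = lookup (toWitness ok) (∈-orientations o)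

  module Translate (p : Point) where

    q : Point
    q = negate p

    based : p ⊕ q ≡ origin
    based = ⊕-inverseʳ p

    side : ∀ {e t} → e ∈ sides t → shiftE q e ∈ sides (shiftT q t)
    side = ∈-sides-shift q

    neighbour : ∀ {e t} → e ∈ sides t → shiftT q t ∈ tilesWithSide (shiftE q e)
    neighbour e∈ = ∈-tilesWithSide _ (side e∈)

    apart : ∀ {x y} → Apart x y → Apart (shiftT q x) (shiftT q y)
    apart = Apart-shift q

    opposite : ∀ {t e f} → Opposite t e f → Opposite (shiftT q t) (shiftE q e) (shiftE q f)
    opposite = Opposite-shift q

  SharedSides : Tile → Set
  SharedSides x = All (λ e → All (λ y → All (λ e′ → x ≢ y → e′ ∈ sides y → e ≡ e′)
                    (sides x)) (tilesWithSide e)) (sides x)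

  abstract
    shared-sides-at-origin : ∀ x → proj₁ x ≡ origin → SharedSides x
    shared-sides-at-origin = at-origin λ x →
      all? (λ e → all? (λ y → all? (λ e′ → ¬? (x ≟ y) →-dec (e′ ∈ₗ? sides y) →-dec (e ≟ e′))
        (sides x)) (tilesWithSide e)) (sides x)

  shared-side-unique : ∀ {x y e e′} → x ≢ y → e ∈ sides x → e ∈ sides y → e′ ∈ sides x → e′ ∈ sides y → e ≡ e′
  shared-side-unique {p , o} x≢y e∈x e∈y e′∈x e′∈y = shiftE-injective q
    ((shared-sides-at-origin _ based ! side e∈x ! neighbour e∈y ! side e′∈x) (x≢y ∘ shiftT-injective q) (side e′∈y))
    where open Translate p

  NeighbourAcross : Tile → Set
  NeighbourAcross x = All (λ e → All (λ y → Apart x y → All (λ z → Apart x z → ¬ Overlap y z → y ≡ z)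
                        (tilesWithSide e)) (tilesWithSide e)) (sides x)

  abstract
    neighbour-across-at-origin : ∀ x → proj₁ x ≡ origin → NeighbourAcross x
    neighbour-across-at-origin = at-origin λ x →
      all? (λ e → all? (λ y → Apart? x y →-dec all? (λ z → Apart? x z →-dec ¬? (Overlap? y z) →-dec (y ≟ z))
        (tilesWithSide e)) (tilesWithSide e)) (sides x)

  neighbour-across-unique : ∀ {x y z e} → Apart x y → Apart x z → ¬ Overlap y z →
                            e ∈ sides x → e ∈ sides y → e ∈ sides z → y ≡ z
  neighbour-across-unique {p , o} xy xz ¬yz e∈x e∈y e∈z = shiftT-injective q
    (((neighbour-across-at-origin _ based ! side e∈x ! neighbour e∈y) (apart xy) ! neighbour e∈z)
      (apart xz) (¬yz ∘ Overlap-unshift q))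
    where open Translate p

  OppositeSides : Tile → Set
  OppositeSides x =
      All (λ (e , f) → All (λ (e′ , f′) → e ≡ e′ → f ≡ f′) (oppositePairs x)) (oppositePairs x)
    × All (λ (e , f) → e ≢ f) (oppositePairs x)
    × All (λ e → All (λ e′ → edgeDir e ≡ edgeDir e′ → e ≡ e′ ⊎ Opposite x e e′) (sides x)) (sides x)

  abstract
    opposite-sides-at-origin : ∀ x → proj₁ x ≡ origin → OppositeSides x
    opposite-sides-at-origin = at-origin λ x →
          all? (λ (e , f) → all? (λ (e′ , f′) → (e ≟ e′) →-dec (f ≟ f′)) (oppositePairs x)) (oppositePairs x)
      ×-dec all? (λ (e , f) → ¬? (e ≟ f)) (oppositePairs x)
      ×-dec all? (λ e → all? (λ e′ → (edgeDir e Fin.≟ edgeDir e′) →-dec ((e ≟ e′) ⊎-dec Opposite? x e e′))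
              (sides x)) (sides x)

  opposite-functional : ∀ {x e f f′} → Opposite x e f → Opposite x e f′ → f ≡ f′
  opposite-functional {p , o} op op′ = shiftE-injective q
    ((proj₁ (opposite-sides-at-origin _ based) ! opposite op ! opposite op′) refl)
    where open Translate p

  opposite-irreflexive : ∀ {x e f} → Opposite x e f → e ≢ f
  opposite-irreflexive {p , o} op e≡f =
    (proj₁ (proj₂ (opposite-sides-at-origin _ based)) ! opposite op) (cong (shiftE q) e≡f)
    where open Translate p

  parallel-sides : ∀ {x e e′} → e ∈ sides x → e′ ∈ sides x → edgeDir e ≡ edgeDir e′ → e ≡ e′ ⊎ Opposite x e e′
  parallel-sides {p , o} e∈ e′∈ parallel =
    Data.Sum.map (shiftE-injective q) (Opposite-unshift q)
      ((proj₂ (proj₂ (opposite-sides-at-origin _ based)) ! side e∈ ! side e′∈) parallel)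
    where open Translate p

  FarSides : Tile → Set
  FarSides x = All (λ e → All (λ y → Apart x y → All (λ f → Opposite x e f → All (λ g → Opposite y e g →
      All (λ z → g ∉ sides z) (tilesWithSide f)) (sides y)) (sides x)) (tilesWithSide e)) (sides x)

  abstract
    far-sides-at-origin : ∀ x → proj₁ x ≡ origin → FarSides x
    far-sides-at-origin = at-origin λ x →
      all? (λ e → all? (λ y → Apart? x y →-dec all? (λ f → Opposite? x e f →-dec all? (λ g → Opposite? y e g →-dec
        all? (λ z → ¬? (g ∈ₗ? sides z)) (tilesWithSide f)) (sides y)) (sides x)) (tilesWithSide e)) (sides x)

  far-sides-unshared : ∀ {x y z e f g} → Apart x y → e ∈ sides x → e ∈ sides y →
                       Opposite x e f → Opposite y e g → f ∈ sides z → g ∉ sides z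
  far-sides-unshared {p , o} xy e∈x e∈y op op′ f∈z g∈z =
    ((((far-sides-at-origin _ based ! side e∈x ! neighbour e∈y) (apart xy) ! side (Opposite⇒∈sides₂ op))
      (opposite op) ! side (Opposite⇒∈sides₂ op′)) (opposite op′) ! neighbour f∈z) (side g∈z)
    where open Translate p

  RowEnds : Tile → Set
  RowEnds t = All (λ f₁ → All (λ m → Apart t m → All (λ f₂ → Opposite m f₁ f₂ → All (λ u → Apart m u → Apart t u →
      All (λ e → e ∉ sides u) (sides t)) (tilesWithSide f₂)) (sides m)) (tilesWithSide f₁)) (sides t)

  abstract
    row-ends-at-origin : ∀ t → proj₁ t ≡ origin → RowEnds t
    row-ends-at-origin = at-origin λ t →
      all? (λ f₁ → all? (λ m → Apart? t m →-dec all? (λ f₂ → Opposite? m f₁ f₂ →-dec all? (λ u →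
        Apart? m u →-dec Apart? t u →-dec all? (λ e → ¬? (e ∈ₗ? sides u)) (sides t))
        (tilesWithSide f₂)) (sides m)) (tilesWithSide f₁)) (sides t)

  row-ends-unshared : ∀ {t m u f₁ f₂ e} → Apart t m → f₁ ∈ sides t → f₁ ∈ sides m → Opposite m f₁ f₂ →
                      f₂ ∈ sides u → Apart m u → Apart t u → e ∈ sides t → e ∉ sides u
  row-ends-unshared {p , o} tm f₁∈t f₁∈m op f₂∈u mu tu e∈t e∈u =
    ((((row-ends-at-origin _ based ! side f₁∈t ! neighbour f₁∈m) (apart tm) ! side (Opposite⇒∈sides₂ op))
      (opposite op) ! neighbour f₂∈u) (apart mu) (apart tu) ! side e∈t) (side e∈u)
    where open Translate p

  RowMiddles : Tile → Set
  RowMiddles t = All (λ a → All (λ m → Apart t m → All (λ b → Opposite m a b → All (λ u → Apart m u →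
      All (λ c → All (λ m′ → Apart t m′ → All (λ d → Opposite m′ c d → d ∈ sides u → m ≡ m′)
    (sides m′)) (tilesWithSide c)) (sides t)) (tilesWithSide b)) (sides m)) (tilesWithSide a)) (sides t)

  abstract
    row-middles-at-origin : ∀ t → proj₁ t ≡ origin → RowMiddles t
    row-middles-at-origin = at-origin λ t →
      all? (λ a → all? (λ m → Apart? t m →-dec all? (λ b → Opposite? m a b →-dec all? (λ u → Apart? m u →-dec
        all? (λ c → all? (λ m′ → Apart? t m′ →-dec all? (λ d → Opposite? m′ c d →-dec (d ∈ₗ? sides u) →-dec (m ≟ m′))
      (sides m′)) (tilesWithSide c)) (sides t)) (tilesWithSide b)) (sides m)) (tilesWithSide a)) (sides t)

  row-middle-unique : ∀ {t m m′ u a b c d} →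
    Apart t m → a ∈ sides t → a ∈ sides m → Opposite m a b → b ∈ sides u → Apart m u →
    Apart t m′ → c ∈ sides t → c ∈ sides m′ → Opposite m′ c d → d ∈ sides u → m ≡ m′
  row-middle-unique {p , o} tm a∈t a∈m op b∈u mu tm′ c∈t c∈m′ op′ d∈u = shiftT-injective q
    ((((((row-middles-at-origin _ based ! side a∈t ! neighbour a∈m) (apart tm) ! side (Opposite⇒∈sides₂ op))
      (opposite op) ! neighbour b∈u) (apart mu) ! side c∈t ! neighbour c∈m′) (apart tm′)
      ! side (Opposite⇒∈sides₂ op′)) (opposite op′) (side d∈u))
    where open Translate p

module Runs (T : List Tile) (tredoku : Tredoku T) where

  open import Data.List using (List; []; _∷_; length; reverse; _∷ʳ_)

  open Lattice
  open Lists using (Unique-length-≤)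
  open import Data.Nat using (zero; suc; _+_; _≤_; _<_; s≤s)
  open import Data.Nat.Properties using (+-suc; +-comm; <-irrefl; ≤-<-trans; <-≤-trans; n<1+n; m≤m+n)
  open import Data.Fin using (zero; suc)
  import Data.Fin.Properties as Fin
  open import Data.Product using (∃-syntax; _×_; _,_; proj₁; proj₂)
  open import Data.Sum using (_⊎_; inj₁; inj₂)
  import Data.Sum
  open import Data.Empty using (⊥; ⊥-elim)
  open import Data.List.Properties using (reverse-involutive; length-++)
  open import Data.List.Membership.Propositional using (_∈_; _∉_)
  open import Data.List.Relation.Binary.Subset.Propositional using (_⊆_)
  import Data.List.Membership.Propositional as Membership
  open import Data.List.Membership.Propositional.Properties using (∈-concatMap⁺; ∈-++⁺ˡ)
  open import Data.List.Relation.Unary.Any using (Any; here; there; any?)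
  import Data.List.Relation.Unary.Any as Any
  open import Data.List.Relation.Unary.All using (All; []; _∷_; all?)
  import Data.List.Relation.Unary.All as All
  import Data.List.Relation.Unary.All.Properties as All
  open import Data.List.Relation.Unary.AllPairs using ([]; _∷_; allPairs?)
  open import Data.List.Relation.Unary.Unique.Propositional using (Unique)
  open import Relation.Binary.Construct.Closure.ReflexiveTransitive using (ε; _◅_)
  open import Relation.Binary.PropositionalEquality
  open import Relation.Binary.PropositionalEquality.Core using (≢-sym)
  open import Relation.Nullary using (Dec; yes; no; ¬_; ¬?)
  open import Function using (_∘_)
  open import Relation.Nullary.Decidable using (map′; _×-dec_)

  unique : Unique T
  unique = proj₁ tredoku

  large : 5 ≤ length T
  large = proj₁ (proj₂ tredoku)

  adjacency-connected : P1 T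
  adjacency-connected = proj₁ (proj₂ (proj₂ tredoku))

  intersections : P2 T
  intersections = proj₁ (proj₂ (proj₂ (proj₂ tredoku)))

  runs-of-three : P45 T
  runs-of-three = proj₁ (proj₂ (proj₂ (proj₂ (proj₂ (proj₂ tredoku)))))

  data IsTriangle : Cell → Set where
    up   : ∀ p → IsTriangle (up p)
    down : ∀ p → IsTriangle (down p)

  triangle : ∀ {c t} → c ∈ triangles t → IsTriangle c
  triangle {t = _ , zero}          (here refl)         = up _
  triangle {t = _ , zero}          (there (here refl)) = down _
  triangle {t = _ , suc zero}      (here refl)         = down _
  triangle {t = _ , suc zero}      (there (here refl)) = up _
  triangle {t = _ , suc (suc zero)} (here refl)         = up _
  triangle {t = _ , suc (suc zero)} (there (here refl)) = down _

  triangle⇒cell : ∀ {c t} → c ∈ triangles t → c ∈ cells t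
  triangle⇒cell c∈ = ∈-concatMap⁺ closure (Any.map (λ { refl → here refl }) c∈)

  triangle∉edge : ∀ {c e} → IsTriangle c → c ∉ closure (edg e)
  triangle∉edge (up _)   (here ())
  triangle∉edge (up _)   (there (here ()))
  triangle∉edge (up _)   (there (there (here ())))
  triangle∉edge (down _) (here ())
  triangle∉edge (down _) (there (here ()))
  triangle∉edge (down _) (there (there (here ())))

  triangle≢vertex : ∀ {c v} → IsTriangle c → c ≢ vtx v
  triangle≢vertex (up _)   ()
  triangle≢vertex (down _) ()

  apart : ∀ {x y} → x ∈ T → y ∈ T → x ≢ y → Apart x y
  apart {x} {y} x∈T y∈T x≢y =
    x≢y , λ (c , c∈x , c∈y) → no-common-triangle (triangle c∈x) (triangle⇒cell c∈x , triangle⇒cell c∈y)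
    where
      no-common-triangle : ∀ {c} → IsTriangle c → ¬ Common x y c
      no-common-triangle tri common with intersections x y x∈T y∈T x≢y
      ... | inj₁ disjoint                  = disjoint _ common
      ... | inj₂ (inj₁ (v , at-vertex))          = triangle≢vertex tri (proj₁ (at-vertex _) common)
      ... | inj₂ (inj₂ (e , _ , _ , along-edge)) = triangle∉edge tri (proj₁ (along-edge _) common)

  neighbour-unique : ∀ {t x x′ e} → t ∈ T → x ∈ T → x′ ∈ T → t ≢ x → t ≢ x′ →
                     e ∈ sides t → e ∈ sides x → e ∈ sides x′ → x ≡ x′
  neighbour-unique {t} {x} {x′} t∈T x∈T x′∈T t≢x t≢x′ e∈t e∈x e∈x′ with x ≟ x′
  ... | yes x≡x′ = x≡x′
  ... | no x≢x′  = neighbour-across-unique (apart t∈T x∈T t≢x) (apart t∈T x′∈T t≢x′)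
                     (proj₂ (apart x∈T x′∈T x≢x′)) e∈t e∈x e∈x′

  -- closed₁ and closed₃ express maximality: no tile of T continues the run past an end.
  record Run (r : List Tile) : Set where
    field
      x₁ x₂ x₃ : Tile
      e₁ e₂    : Edge
      r≡       : r ≡ x₁ ∷ x₂ ∷ x₃ ∷ []
      x₁∈T     : x₁ ∈ T
      x₂∈T     : x₂ ∈ T
      x₃∈T     : x₃ ∈ T
      x₁≢x₂    : x₁ ≢ x₂
      x₁≢x₃    : x₁ ≢ x₃
      x₂≢x₃    : x₂ ≢ x₃
      e₁∈x₁    : e₁ ∈ sides x₁
      e₁∈x₂    : e₁ ∈ sides x₂
      e₂∈x₃    : e₂ ∈ sides x₃
      across   : Opposite x₂ e₁ e₂
      closed₁  : ∀ {w g} → w ∈ T → w ≢ x₁ → g ∈ sides w → ¬ Opposite x₁ e₁ g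
      closed₃  : ∀ {w g} → w ∈ T → w ≢ x₃ → g ∈ sides w → ¬ Opposite x₃ e₂ g

    e₂∈x₂ : e₂ ∈ sides x₂
    e₂∈x₂ = Opposite⇒∈sides₂ across

    x₁∈r : x₁ ∈ r
    x₁∈r = subst (x₁ ∈_) (sym r≡) (here refl)

    x₂∈r : x₂ ∈ r
    x₂∈r = subst (x₂ ∈_) (sym r≡) (there (here refl))

    x₃∈r : x₃ ∈ r
    x₃∈r = subst (x₃ ∈_) (sym r≡) (there (there (here refl)))

  run-view : ∀ r → IsRun T r → Run r
  run-view r run with three-elements r (runs-of-three r run)
    where
      three-elements : ∀ (r : List Tile) → length r ≡ 3 → ∃[ x₁ ] ∃[ x₂ ] ∃[ x₃ ] (r ≡ x₁ ∷ x₂ ∷ x₃ ∷ [])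
      three-elements (x₁ ∷ x₂ ∷ x₃ ∷ []) refl = x₁ , x₂ , x₃ , refl
  run-view .(x₁ ∷ x₂ ∷ x₃ ∷ [])
           ((x₁∈T ∷ x₂∈T ∷ x₃∈T ∷ [] , (x₁≢x₂ ∷ x₁≢x₃ ∷ []) ∷ (x₂≢x₃ ∷ []) ∷ [] ∷ [] ,
             start e₁ e₁∈x₁ e₁∈x₂ (step e₂ across e₂∈x₃ parallel end)) , no-before , no-after)
           | x₁ , x₂ , x₃ , refl = record
    { x₁ = x₁ ; x₂ = x₂ ; x₃ = x₃ ; e₁ = e₁ ; e₂ = e₂ ; r≡ = refl
    ; x₁∈T = x₁∈T ; x₂∈T = x₂∈T ; x₃∈T = x₃∈T ; x₁≢x₂ = x₁≢x₂ ; x₁≢x₃ = x₁≢x₃ ; x₂≢x₃ = x₂≢x₃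
    ; e₁∈x₁ = e₁∈x₁ ; e₁∈x₂ = e₁∈x₂ ; e₂∈x₃ = e₂∈x₃ ; across = across
    ; closed₁ = closed₁ ; closed₃ = closed₃ }
    where
      closed₁ : ∀ {w g} → w ∈ T → w ≢ x₁ → g ∈ sides w → ¬ Opposite x₁ e₁ g
      closed₁ {w} {g} w∈T w≢x₁ g∈w op = no-before w
        ( w∈T ∷ x₁∈T ∷ x₂∈T ∷ x₃∈T ∷ []
        , (w≢x₁ ∷ w≢x₂ ∷ w≢x₃ ∷ []) ∷ (x₁≢x₂ ∷ x₁≢x₃ ∷ []) ∷ (x₂≢x₃ ∷ []) ∷ [] ∷ []
        , start g g∈w (Opposite⇒∈sides₂ op)
            (step e₁ (Opposite-sym op) e₁∈x₂ (sym (Opposite⇒parallel op)) (step e₂ across e₂∈x₃ parallel end)))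
        where
          w≢x₂ : w ≢ x₂
          w≢x₂ refl = opposite-irreflexive op (shared-side-unique x₁≢x₂ e₁∈x₁ e₁∈x₂ (Opposite⇒∈sides₂ op) g∈w)
          w≢x₃ : w ≢ x₃
          w≢x₃ refl = far-sides-unshared (apart x₂∈T x₁∈T (≢-sym x₁≢x₂)) e₁∈x₂ e₁∈x₁ across op e₂∈x₃ g∈w
      closed₃ : ∀ {w g} → w ∈ T → w ≢ x₃ → g ∈ sides w → ¬ Opposite x₃ e₂ g
      closed₃ {w} {g} w∈T w≢x₃ g∈w op = no-after w
        ( x₁∈T ∷ x₂∈T ∷ x₃∈T ∷ w∈T ∷ []
        , (x₁≢x₂ ∷ x₁≢x₃ ∷ x₁≢w ∷ []) ∷ (x₂≢x₃ ∷ x₂≢w ∷ []) ∷ (≢-sym w≢x₃ ∷ []) ∷ [] ∷ []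
        , start e₁ e₁∈x₁ e₁∈x₂ (step e₂ across e₂∈x₃ parallel (step g op g∈w (Opposite⇒parallel op) end)))
        where
          x₁≢w : x₁ ≢ w
          x₁≢w refl = far-sides-unshared (apart x₂∈T x₃∈T x₂≢x₃) (Opposite⇒∈sides₂ across) e₂∈x₃
                        (Opposite-sym across) op e₁∈x₁ g∈w
          x₂≢w : x₂ ≢ w
          x₂≢w refl = opposite-irreflexive op
                        (shared-side-unique (≢-sym x₂≢x₃) e₂∈x₃ (Opposite⇒∈sides₂ across) (Opposite⇒∈sides₂ op) g∈w)

  SameRun-sym : ∀ {r r′} → SameRun r r′ → SameRun r′ r
  SameRun-sym (inj₁ r≡r′)         = inj₁ (sym r≡r′)
  SameRun-sym {r} {r′} (inj₂ r≡) = inj₂ (sym (trans (cong reverse r≡) (reverse-involutive r′)))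

  SameRun-trans : ∀ {r r′ r″} → SameRun r r′ → SameRun r′ r″ → SameRun r r″
  SameRun-trans (inj₁ refl) s           = s
  SameRun-trans (inj₂ refl) (inj₁ refl) = inj₂ refl
  SameRun-trans (inj₂ refl) (inj₂ refl) = inj₁ (reverse-involutive _)

  SameRun-∈ : ∀ {r r′ t} → SameRun r r′ → t ∈ r′ → t ∈ r
  SameRun-∈ (inj₁ refl) t∈ = t∈
  SameRun-∈ (inj₂ refl) t∈ = Data.List.Relation.Unary.Any.Properties.reverse⁺ t∈
    where import Data.List.Relation.Unary.Any.Properties

  record End (r : List Tile) (t : Tile) (e : Edge) : Set where
    constructor mkEnd
    field
      next far  : Tile
      e′        : Edge
      r~        : SameRun r (t ∷ next ∷ far ∷ [])
      next∈T    : next ∈ T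
      far∈T     : far ∈ T
      t≢next    : t ≢ next
      next≢far  : next ≢ far
      e∈t       : e ∈ sides t
      e∈next    : e ∈ sides next
      across    : Opposite next e e′
      e′∈far    : e′ ∈ sides far
      closed    : ∀ {w g} → w ∈ T → w ≢ t → g ∈ sides w → ¬ Opposite t e g

  record Middle (r : List Tile) (t : Tile) (a b : Edge) : Set where
    constructor mkMiddle
    field
      prev next : Tile
      r≡        : r ≡ prev ∷ t ∷ next ∷ []
      prev∈T    : prev ∈ T
      next∈T    : next ∈ T
      t≢prev    : t ≢ prev
      t≢next    : t ≢ next
      a∈prev    : a ∈ sides prev
      a∈t       : a ∈ sides t
      across    : Opposite t a b
      b∈next    : b ∈ sides next

  Crosses : List Tile → Tile → Edge → Set
  Crosses r t e = End r t e ⊎ ∃[ a ] ∃[ b ] (Middle r t a b × (e ≡ a ⊎ e ≡ b))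

  Crosses⇒∈sides : ∀ {r t e} → Crosses r t e → e ∈ sides t
  Crosses⇒∈sides (inj₁ E)                       = End.e∈t E
  Crosses⇒∈sides (inj₂ (_ , _ , M , inj₁ refl)) = Middle.a∈t M
  Crosses⇒∈sides (inj₂ (_ , _ , M , inj₂ refl)) = Opposite⇒∈sides₂ (Middle.across M)

  module _ {t} (t∈T : t ∈ T) where

    end-end : ∀ {r r′ e} → End r t e → End r′ t e → SameRun r r′
    end-end (mkEnd x z _ r~ x∈T z∈T t≢x x≢z e∈t e∈x op e′∈z _) (mkEnd x′ z′ _ r~′ x′∈T z′∈T t≢x′ x′≢z′ _ e∈x′ op′ e′∈z′ _)
      with neighbour-unique t∈T x∈T x′∈T t≢x t≢x′ e∈t e∈x e∈x′
    ... | refl with opposite-functional op op′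
    ... | refl with neighbour-unique x∈T z∈T z′∈T x≢z x′≢z′ (Opposite⇒∈sides₂ op) e′∈z e′∈z′
    ... | refl = SameRun-trans r~ (SameRun-sym r~′)

    end-middle : ∀ {r r′ e a b} → End r t e → Middle r′ t a b → edgeDir e ≡ edgeDir a → ⊥
    end-middle E M parallel with parallel-sides (End.e∈t E) (Middle.a∈t M) parallel
    ... | inj₁ refl = End.closed E (Middle.next∈T M) (≢-sym (Middle.t≢next M)) (Middle.b∈next M) (Middle.across M)
    ... | inj₂ op   = End.closed E (Middle.prev∈T M) (≢-sym (Middle.t≢prev M)) (Middle.a∈prev M) op

    middle-middle : ∀ {r r′ a b a′ b′} → Middle r t a b → Middle r′ t a′ b′ → edgeDir a ≡ edgeDir a′ → SameRun r r′
    middle-middle (mkMiddle x z r≡ x∈T z∈T t≢x t≢z a∈x a∈t op b∈z)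
                  (mkMiddle x′ z′ r≡′ x′∈T z′∈T t≢x′ t≢z′ a′∈x′ a′∈t op′ b′∈z′) parallel
      with parallel-sides a∈t a′∈t parallel
    ... | inj₁ refl with neighbour-unique t∈T x∈T x′∈T t≢x t≢x′ a∈t a∈x a′∈x′ | opposite-functional op op′
    ...   | refl | refl with neighbour-unique t∈T z∈T z′∈T t≢z t≢z′ (Opposite⇒∈sides₂ op) b∈z b′∈z′
    ...     | refl = inj₁ (trans r≡ (sym r≡′))
    middle-middle (mkMiddle x z r≡ x∈T z∈T t≢x t≢z a∈x a∈t op b∈z)
                  (mkMiddle x′ z′ r≡′ x′∈T z′∈T t≢x′ t≢z′ a′∈x′ a′∈t op′ b′∈z′) parallel
      | inj₂ a~a′ with opposite-functional op a~a′
    ... | refl with opposite-functional (Opposite-sym op) op′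
    ... | refl with neighbour-unique t∈T z∈T x′∈T t≢z t≢x′ (Opposite⇒∈sides₂ op) b∈z a′∈x′
                         | neighbour-unique t∈T x∈T z′∈T t≢x t≢z′ a∈t a∈x b′∈z′
    ...   | refl | refl = inj₂ (trans r≡ (cong reverse (sym r≡′)))

    crossing-direction : ∀ {r e a b} → Middle r t a b → e ≡ a ⊎ e ≡ b → edgeDir e ≡ edgeDir a
    crossing-direction M (inj₁ refl) = refl
    crossing-direction M (inj₂ refl) = sym (Opposite⇒parallel (Middle.across M))

    parallel-crossings⇒SameRun : ∀ {r r′ e e′} → Crosses r t e → Crosses r′ t e′ → edgeDir e ≡ edgeDir e′ → SameRun r r′
    parallel-crossings⇒SameRun (inj₁ E) (inj₁ E′) parallel with parallel-sides (End.e∈t E) (End.e∈t E′) parallel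
    ... | inj₁ refl = end-end E E′
    ... | inj₂ op   = ⊥-elim (End.closed E (End.next∈T E′) (≢-sym (End.t≢next E′)) (End.e∈next E′) op)
    parallel-crossings⇒SameRun (inj₁ E) (inj₂ (_ , _ , M , e′~)) parallel =
      ⊥-elim (end-middle E M (trans parallel (crossing-direction M e′~)))
    parallel-crossings⇒SameRun (inj₂ (_ , _ , M , e~)) (inj₁ E) parallel =
      ⊥-elim (end-middle E M (trans (sym parallel) (crossing-direction M e~)))
    parallel-crossings⇒SameRun (inj₂ (_ , _ , M , e~)) (inj₂ (_ , _ , M′ , e′~)) parallel =
      middle-middle M M′ (trans (sym (crossing-direction M e~)) (trans parallel (crossing-direction M′ e′~)))

  record Beside (r : List Tile) (t u : Tile) : Set where
    constructor mkBeside
    field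
      e       : Edge
      crosses : Crosses r t e
      e∈u     : e ∈ sides u

  record Beyond (r : List Tile) (t u : Tile) : Set where
    constructor mkBeyond
    field
      m       : Tile
      a b     : Edge
      crosses : Crosses r t a
      m∈T     : m ∈ T
      t≢m     : t ≢ m
      m≢u     : m ≢ u
      a∈m     : a ∈ sides m
      across  : Opposite m a b
      b∈u     : b ∈ sides u

  module _ {r} (R : Run r) where
    open Run R

    end₁ : End r x₁ e₁
    end₁ = mkEnd x₂ x₃ e₂ (inj₁ r≡) x₂∈T x₃∈T x₁≢x₂ x₂≢x₃ e₁∈x₁ e₁∈x₂ across e₂∈x₃ closed₁

    end₃ : End r x₃ e₂
    end₃ = mkEnd x₂ x₁ e₁ (inj₂ r≡) x₂∈T x₁∈T (≢-sym x₂≢x₃) (≢-sym x₁≢x₂) e₂∈x₃ e₂∈x₂ (Opposite-sym across) e₁∈x₁ closed₃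

    middle₂ : Middle r x₂ e₁ e₂
    middle₂ = mkMiddle x₁ x₃ r≡ x₁∈T x₃∈T (≢-sym x₁≢x₂) x₂≢x₃ e₁∈x₁ e₁∈x₂ across e₂∈x₃

    ∈-run⇒∈T : ∀ {t} → t ∈ r → t ∈ T
    ∈-run⇒∈T t∈ with subst (_ ∈_) r≡ t∈
    ... | here refl                 = x₁∈T
    ... | there (here refl)         = x₂∈T
    ... | there (there (here refl)) = x₃∈T

    crossing : ∀ {t} → t ∈ r → ∃[ e ] Crosses r t e
    crossing t∈ with subst (_ ∈_) r≡ t∈
    ... | here refl                 = e₁ , inj₁ end₁
    ... | there (here refl)         = e₁ , inj₂ (e₁ , e₂ , middle₂ , inj₁ refl)
    ... | there (there (here refl)) = e₂ , inj₁ end₃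

    beside-or-beyond : ∀ {t u} → t ∈ r → u ∈ r → t ≢ u → Beside r t u ⊎ Beyond r t u
    beside-or-beyond t∈ u∈ t≢u with subst (_ ∈_) r≡ t∈ | subst (_ ∈_) r≡ u∈
    ... | here refl                 | here refl                 = ⊥-elim (t≢u refl)
    ... | here refl                 | there (here refl)         = inj₁ (mkBeside e₁ (inj₁ end₁) e₁∈x₂)
    ... | here refl                 | there (there (here refl)) =
      inj₂ (mkBeyond x₂ e₁ e₂ (inj₁ end₁) x₂∈T x₁≢x₂ x₂≢x₃ e₁∈x₂ across e₂∈x₃)
    ... | there (here refl)         | here refl                 =
      inj₁ (mkBeside e₁ (inj₂ (e₁ , e₂ , middle₂ , inj₁ refl)) e₁∈x₁)
    ... | there (here refl)         | there (here refl)         = ⊥-elim (t≢u refl)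
    ... | there (here refl)         | there (there (here refl)) =
      inj₁ (mkBeside e₂ (inj₂ (e₁ , e₂ , middle₂ , inj₂ refl)) e₂∈x₃)
    ... | there (there (here refl)) | here refl                 =
      inj₂ (mkBeyond x₂ e₂ e₁ (inj₁ end₃) x₂∈T (≢-sym x₂≢x₃) (≢-sym x₁≢x₂) e₂∈x₂ (Opposite-sym across) e₁∈x₁)
    ... | there (there (here refl)) | there (here refl)         = inj₁ (mkBeside e₂ (inj₁ end₃) e₂∈x₂)
    ... | there (there (here refl)) | there (there (here refl)) = ⊥-elim (t≢u refl)

  module _ {t u} (t∈T : t ∈ T) (u∈T : u ∈ T) (t≢u : t ≢ u) where

    beside-beside : ∀ {r r′} → Beside r t u → Beside r′ t u → SameRun r r′
    beside-beside (mkBeside e c e∈u) (mkBeside e′ c′ e′∈u) = parallel-crossings⇒SameRun t∈T c c′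
      (cong edgeDir (shared-side-unique t≢u (Crosses⇒∈sides c) e∈u (Crosses⇒∈sides c′) e′∈u))

    beside-beyond : ∀ {r r′} → Beside r t u → Beyond r′ t u → ⊥
    beside-beyond (mkBeside e c e∈u) (mkBeyond m a b c′ m∈T t≢m m≢u a∈m op b∈u) =
      row-ends-unshared (apart t∈T m∈T t≢m) (Crosses⇒∈sides c′) a∈m op b∈u (apart m∈T u∈T m≢u)
        (apart t∈T u∈T t≢u) (Crosses⇒∈sides c) e∈u

    beyond-beyond : ∀ {r r′} → Beyond r t u → Beyond r′ t u → SameRun r r′
    beyond-beyond (mkBeyond m a b c m∈T t≢m m≢u a∈m op b∈u) (mkBeyond m′ a′ b′ c′ m′∈T t≢m′ m′≢u a′∈m′ op′ b′∈u) =
      parallel-crossings⇒SameRun t∈T c c′ (cong edgeDir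
        (shared-side-unique t≢m (Crosses⇒∈sides c) a∈m (Crosses⇒∈sides c′) (subst (λ x → a′ ∈ sides x) (sym m≡m′) a′∈m′)))
      where
        m≡m′ : m ≡ m′
        m≡m′ = row-middle-unique (apart t∈T m∈T t≢m) (Crosses⇒∈sides c) a∈m op b∈u (apart m∈T u∈T m≢u)
                                 (apart t∈T m′∈T t≢m′) (Crosses⇒∈sides c′) a′∈m′ op′ b′∈u

  two-common-tiles⇒SameRun : ∀ {r r′ t u} → IsRun T r → IsRun T r′ →
    t ∈ r → u ∈ r → t ∈ r′ → u ∈ r′ → t ≢ u → SameRun r r′
  two-common-tiles⇒SameRun {r} {r′} {t} {u} run run′ t∈r u∈r t∈r′ u∈r′ t≢u =
    combine (beside-or-beyond R t∈r u∈r t≢u) (beside-or-beyond (run-view r′ run′) t∈r′ u∈r′ t≢u)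
    where
      R = run-view r run
      t∈T = ∈-run⇒∈T R t∈r
      u∈T = ∈-run⇒∈T R u∈r
      combine : Beside r t u ⊎ Beyond r t u → Beside r′ t u ⊎ Beyond r′ t u → SameRun r r′
      combine (inj₁ S) (inj₁ S′) = beside-beside t∈T u∈T t≢u S S′
      combine (inj₁ S) (inj₂ B′) = ⊥-elim (beside-beyond t∈T u∈T t≢u S B′)
      combine (inj₂ B) (inj₁ S′) = ⊥-elim (beside-beyond t∈T u∈T t≢u S′ B)
      combine (inj₂ B) (inj₂ B′) = beyond-beyond t∈T u∈T t≢u B B′

  side-direction : ∀ {e p o} → e ∈ sides (p , o) → edgeDir e ≡ sa o ⊎ edgeDir e ≡ sb o
  side-direction (here refl)                         = inj₁ refl
  side-direction (there (here refl))                 = inj₁ refl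
  side-direction (there (there (here refl)))         = inj₂ refl
  side-direction (there (there (there (here refl)))) = inj₂ refl

  two-values : ∀ {A : Set} {a b x y z : A} → x ≡ a ⊎ x ≡ b → y ≡ a ⊎ y ≡ b → z ≡ a ⊎ z ≡ b →
               x ≡ y ⊎ x ≡ z ⊎ y ≡ z
  two-values (inj₁ refl) (inj₁ refl) _           = inj₁ refl
  two-values (inj₂ refl) (inj₂ refl) _           = inj₁ refl
  two-values (inj₁ refl) (inj₂ refl) (inj₁ refl) = inj₂ (inj₁ refl)
  two-values (inj₁ refl) (inj₂ refl) (inj₂ refl) = inj₂ (inj₂ refl)
  two-values (inj₂ refl) (inj₁ refl) (inj₁ refl) = inj₂ (inj₂ refl)
  two-values (inj₂ refl) (inj₁ refl) (inj₂ refl) = inj₂ (inj₁ refl)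

  at-most-two-runs : ∀ {r₁ r₂ r₃ t} → IsRun T r₁ → IsRun T r₂ → IsRun T r₃ → t ∈ r₁ → t ∈ r₂ → t ∈ r₃ →
                     SameRun r₁ r₂ ⊎ SameRun r₁ r₃ ⊎ SameRun r₂ r₃
  at-most-two-runs {r₁} {r₂} {r₃} {p , o} run₁ run₂ run₃ t∈r₁ t∈r₂ t∈r₃ =
    Data.Sum.map (same c₁ c₂) (Data.Sum.map (same c₁ c₃) (same c₂ c₃))
      (two-values (direction c₁) (direction c₂) (direction c₃))
    where
      R₁ = run-view r₁ run₁
      same = parallel-crossings⇒SameRun (∈-run⇒∈T R₁ t∈r₁)
      c₁ = proj₂ (crossing R₁ t∈r₁)
      c₂ = proj₂ (crossing (run-view r₂ run₂) t∈r₂)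
      c₃ = proj₂ (crossing (run-view r₃ run₃) t∈r₃)
      direction : ∀ {r e} → Crosses r (p , o) e → edgeDir e ≡ sa o ⊎ edgeDir e ≡ sb o
      direction = side-direction ∘ Crosses⇒∈sides

  ChainFrom? : ∀ t e us → Dec (ChainFrom t e us)
  ChainFrom? t e []       = yes end
  ChainFrom? t e (u ∷ us) = map′ from to (any? (λ e′ → Opposite? t e e′ ×-dec (e′ ∈ₗ? sides u)
                                    ×-dec (edgeDir e Fin.≟ edgeDir e′) ×-dec ChainFrom? u e′ us) (sides t))
    where
      Next : Edge → Set
      Next e′ = Opposite t e e′ × e′ ∈ sides u × edgeDir e ≡ edgeDir e′ × ChainFrom u e′ us
      from : Any Next (sides t) → ChainFrom t e (u ∷ us)
      from found = let (e′ , _ , op , e′∈u , parallel , chain) = Membership.find found in step e′ op e′∈u parallel chain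
      to : ChainFrom t e (u ∷ us) → Any Next (sides t)
      to (step e′ op e′∈u parallel chain) = Membership.lose (Opposite⇒∈sides₂ op) (op , e′∈u , parallel , chain)

  RunSeq? : ∀ ts → Dec (RunSeq ts)
  RunSeq? []             = no λ ()
  RunSeq? (_ ∷ [])       = no λ ()
  RunSeq? (t₁ ∷ t₂ ∷ ts) = map′ from to (any? (λ e → (e ∈ₗ? sides t₂) ×-dec ChainFrom? t₂ e ts) (sides t₁))
    where
      First : Edge → Set
      First e = e ∈ sides t₂ × ChainFrom t₂ e ts
      from : Any First (sides t₁) → RunSeq (t₁ ∷ t₂ ∷ ts)
      from found = let (e , e∈t₁ , e∈t₂ , chain) = Membership.find found in start e e∈t₁ e∈t₂ chain
      to : RunSeq (t₁ ∷ t₂ ∷ ts) → Any First (sides t₁)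
      to (start e e∈t₁ e∈t₂ chain) = Membership.lose e∈t₁ (e∈t₂ , chain)

  SeqIn? : ∀ ts → Dec (SeqIn T ts)
  SeqIn? ts = all? (_∈ₗ? T) ts ×-dec allPairs? (λ x y → ¬? (x ≟ y)) ts ×-dec RunSeq? ts

  -- The fuel cannot run out: a sequence of distinct tiles of T is no longer than T.
  extend-to-run : ∀ fuel s → length T < fuel + length s → SeqIn T s → ∃[ r ] (IsRun T r × s ⊆ r)
  extend-to-run zero s bound (s⊆T , s-unique , _) =
    ⊥-elim (<-irrefl refl (≤-<-trans (Unique-length-≤ s-unique s⊆T) bound))
  extend-to-run (suc fuel) s bound seq with any? (λ t → SeqIn? (t ∷ s)) T | any? (λ t → SeqIn? (s ∷ʳ t)) T
  ... | yes before | _ =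
    let (t , _ , seq′) = Membership.find before
        (r , run , ⊆r) = extend-to-run fuel (t ∷ s) (subst (length T <_) (sym (+-suc fuel (length s))) bound) seq′
    in r , run , ⊆r ∘ there
  ... | no _ | yes after =
    let (t , _ , seq′) = Membership.find after
        bound′ = subst (length T <_) (trans (sym (+-suc fuel (length s)))
                   (cong (fuel +_) (trans (+-comm 1 (length s)) (sym (length-++ s))))) bound
        (r , run , ⊆r) = extend-to-run fuel (s ∷ʳ t) bound′ seq′
    in r , run , ⊆r ∘ ∈-++⁺ˡ
  ... | no ¬before | no ¬after =
    s , (seq , (λ t seq′ → ¬before (Membership.lose (All.head (proj₁ seq′)) seq′))
             , (λ t seq′ → ¬after (Membership.lose (proj₂ (All.∷ʳ⁻ (proj₁ seq′))) seq′))) , λ t∈ → t∈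

  adjacent⇒common-run : ∀ {x y} → x ∈ T → y ∈ T → Adjacent x y → ∃[ r ] (IsRun T r × x ∈ r × y ∈ r)
  adjacent⇒common-run {x} {y} x∈T y∈T (x≢y , e , e∈x , e∈y) =
    let (r , run , ⊆r) = extend-to-run (suc (length T)) (x ∷ y ∷ [])
                           (<-≤-trans (n<1+n (length T)) (m≤m+n (suc (length T)) 2))
                           (x∈T ∷ y∈T ∷ [] , (x≢y ∷ []) ∷ [] ∷ [] , start e e∈x e∈y end)
    in r , run , ⊆r (here refl) , ⊆r (there (here refl))

  in-some-run : ∀ {t} → t ∈ T → ∃[ r ] (IsRun T r × t ∈ r)
  in-some-run {t} t∈T with another-tile T unique large
    where
      another-tile : ∀ (L : List Tile) → Unique L → 5 ≤ length L → ∃[ u ] (u ∈ L × t ≢ u)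
      another-tile (_ ∷ [])    _                 (s≤s ())
      another-tile (a ∷ b ∷ _) ((a≢b ∷ _) ∷ _) _ with t ≟ a
      ... | yes refl = b , there (here refl) , a≢b
      ... | no t≢a   = a , here refl , t≢a
  ... | u , u∈T , t≢u with adjacency-connected t u t∈T u∈T
  ...   | ε = ⊥-elim (t≢u refl)
  ...   | (_ , v∈T , adjacent) ◅ _ = let (r , run , t∈r , _) = adjacent⇒common-run t∈T v∈T adjacent in r , run , t∈r

module RunGraphs (T : List Tile) (tredoku : Tredoku T) (ρ : ℕ) (Rs : Fin ρ → List Tile)
                 (enumeration : RunEnumeration T ρ Rs) where

  open Lists
  open EdgeLists
  open Lattice using (_≟_; _∈ₗ?_)
  open Runs T tredoku
  open import Data.Nat using (suc; _+_; _*_; _≤_)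
  open import Data.Nat.Properties using (+-comm; *-comm; *-identityʳ; +-cancelˡ-≡; +-cancelʳ-≡; 1+n≰n)
  open import Data.Nat.Tactic.RingSolver using (solve-∀)
  import Data.Fin as Fin
  open import Data.Product using (∃-syntax; _×_; _,_; proj₁; proj₂)
  open import Data.Sum using (_⊎_; inj₁; inj₂)
  import Data.Sum
  open import Data.Empty using (⊥-elim)
  open import Data.List using ([]; _∷_; length; allFin; filter; concatMap)
  open import Data.List.Properties using (length-tabulate)
  open import Data.List.Membership.Propositional using (_∈_; find; lose)
  open import Data.List.Membership.Propositional.Properties
    using (∈-allFin; ∈-filter⁺; ∈-filter⁻; ∈-concatMap⁺; ∈-concatMap⁻)
  open import Data.List.Relation.Unary.Any using (here; there; any?)
  import Data.List.Relation.Unary.Any as Any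
  open import Data.List.Relation.Unary.All using (All; []; _∷_)
  import Data.List.Relation.Unary.All as All
  open import Data.List.Relation.Unary.AllPairs using (AllPairs; []; _∷_)
  open import Data.List.Relation.Unary.Unique.Propositional using (Unique)
  open import Data.List.Relation.Unary.Unique.Propositional.Properties using (allFin⁺)
  import Data.List.Relation.Unary.Unique.Propositional.Properties as Unique
  open import Function using (_⇔_; mk⇔; _∘_)
  open import Function.Bundles using (Equivalence)
  open import Relation.Binary.Construct.Closure.ReflexiveTransitive using (Star; ε; _◅_; _◅◅_)
  open import Relation.Binary.PropositionalEquality
  open import Relation.Binary.PropositionalEquality.Core using (≢-sym)
  open import Relation.Nullary using (yes; no; ¬_; ¬?)
  open import Relation.Nullary.Decidable using (_×-dec_)

  is-run : ∀ i → IsRun T (Rs i)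
  is-run = proj₁ enumeration

  index-injective : ∀ {i j} → SameRun (Rs i) (Rs j) → i ≡ j
  index-injective = proj₂ (proj₂ enumeration) _ _

  index-of : ∀ {r t} → IsRun T r → t ∈ r → ∃[ i ] (SameRun r (Rs i) × t ∈ Rs i)
  index-of {r} run t∈r = let (i , r~) = proj₁ (proj₂ enumeration) r run in i , r~ , SameRun-∈ (SameRun-sym r~) t∈r

  ∈Rs⇒∈T : ∀ {t i} → t ∈ Rs i → t ∈ T
  ∈Rs⇒∈T {i = i} = ∈-run⇒∈T (run-view (Rs i) (is-run i))

  three-runs : ∀ {t i j k} → t ∈ Rs i → t ∈ Rs j → t ∈ Rs k → i ≡ j ⊎ i ≡ k ⊎ j ≡ k
  three-runs {i = i} {j} {k} t∈i t∈j t∈k =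
    Data.Sum.map index-injective (Data.Sum.map index-injective index-injective)
      (at-most-two-runs (is-run i) (is-run j) (is-run k) t∈i t∈j t∈k)

  second-run-unique : ∀ {t i j k} → t ∈ Rs i → t ∈ Rs j → t ∈ Rs k → i ≢ j → i ≢ k → j ≡ k
  second-run-unique t∈i t∈j t∈k i≢j i≢k with three-runs t∈i t∈j t∈k
  ... | inj₁ i≡j        = ⊥-elim (i≢j i≡j)
  ... | inj₂ (inj₁ i≡k) = ⊥-elim (i≢k i≡k)
  ... | inj₂ (inj₂ j≡k) = j≡k

  two-common-tiles : ∀ {t u i j} → t ≢ u → t ∈ Rs i → u ∈ Rs i → t ∈ Rs j → u ∈ Rs j → i ≡ j
  two-common-tiles t≢u t∈i u∈i t∈j u∈j =
    index-injective (two-common-tiles⇒SameRun (is-run _) (is-run _) t∈i u∈i t∈j u∈j t≢u)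

  member : ∀ i → ∃[ t ] (t ∈ Rs i)
  member i = let open Run (run-view (Rs i) (is-run i)) in x₁ , x₁∈r

  link : ∀ {t i j} → t ∈ Rs i → t ∈ Rs j → Star (RunGraph Rs) i j
  link {t} {i} {j} t∈i t∈j with i Fin.≟ j
  ... | yes refl = ε
  ... | no i≢j   = (i≢j , t , t∈i , t∈j) ◅ ε

  run-graph-connected : GraphConnected ρ (RunGraph Rs)
  run-graph-connected i j =
    let (t , t∈i) = member i ; (u , u∈j) = member j in walk (adjacency-connected t u (∈Rs⇒∈T t∈i) (∈Rs⇒∈T u∈j)) t∈i u∈j
    where
      walk : ∀ {t u i j} → Star (λ a b → a ∈ T × b ∈ T × Adjacent a b) t u → t ∈ Rs i → u ∈ Rs j → Star (RunGraph Rs) i j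
      walk ε                            t∈i t∈j = link t∈i t∈j
      walk ((a∈T , b∈T , adjacent) ◅ path) a∈i u∈j =
        let (r , run , a∈r , b∈r) = adjacent⇒common-run a∈T b∈T adjacent
            (k , r~k , a∈k) = index-of run a∈r
        in link a∈i a∈k ◅◅ walk path (SameRun-∈ (SameRun-sym r~k) b∈r) u∈j

  leaf-or-second-run : ∀ {t i} → t ∈ Rs i → IsLeaf T t ⊎ ∃[ j ] (i ≢ j × t ∈ Rs j)
  leaf-or-second-run {t} {i} t∈i with any? (λ j → ¬? (i Fin.≟ j) ×-dec (t ∈ₗ? Rs j)) (allFin ρ)
  ... | yes found = let (j , _ , i≢j , t∈j) = find found in inj₂ (j , i≢j , t∈j)
  ... | no none   = inj₁ (Rs i , is-run i , t∈i , only-run)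
    where
      only-run : ∀ r → IsRun T r → t ∈ r → SameRun r (Rs i)
      only-run r run t∈r with index-of run t∈r
      ... | k , r~k , t∈k with i Fin.≟ k
      ...   | yes refl = r~k
      ...   | no i≢k   = ⊥-elim (none (lose (∈-allFin k) (i≢k , t∈k)))

  no-leaves⇒cubic : (∀ t → t ∈ T → ¬ IsLeaf T t) → Cubic ρ (RunGraph Rs)
  no-leaves⇒cubic no-leaves i =
    other x₁∈r , other x₂∈r , other x₃∈r ,
    distinct x₁≢x₂ x₁∈r x₂∈r , distinct x₁≢x₃ x₁∈r x₃∈r , distinct x₂≢x₃ x₂∈r x₃∈r ,
    joined x₁∈r , joined x₂∈r , joined x₃∈r , only
    where
      open Run (run-view (Rs i) (is-run i))

      second : ∀ {t} → t ∈ Rs i → ∃[ j ] (i ≢ j × t ∈ Rs j)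
      second t∈i with leaf-or-second-run t∈i
      ... | inj₁ leaf  = ⊥-elim (no-leaves _ (∈Rs⇒∈T t∈i) leaf)
      ... | inj₂ found = found

      other : ∀ {t} → t ∈ Rs i → Fin ρ
      other = proj₁ ∘ second

      ∈-other : ∀ {t} (t∈i : t ∈ Rs i) → t ∈ Rs (other t∈i)
      ∈-other = proj₂ ∘ proj₂ ∘ second

      joined : ∀ {t} (t∈i : t ∈ Rs i) → RunGraph Rs i (other t∈i)
      joined t∈i = proj₁ (proj₂ (second t∈i)) , _ , t∈i , ∈-other t∈i

      distinct : ∀ {t u} → t ≢ u → (t∈i : t ∈ Rs i) (u∈i : u ∈ Rs i) → other t∈i ≢ other u∈i
      distinct t≢u t∈i u∈i same = proj₁ (joined t∈i)
        (two-common-tiles t≢u t∈i u∈i (∈-other t∈i) (subst (λ j → _ ∈ Rs j) (sym same) (∈-other u∈i)))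

      same-other : ∀ {t j} (t∈i : t ∈ Rs i) → RunGraph Rs i j → t ∈ Rs j → j ≡ other t∈i
      same-other t∈i (i≢j , _) t∈j = second-run-unique t∈i t∈j (∈-other t∈i) i≢j (proj₁ (joined t∈i))

      only : ∀ j → RunGraph Rs i j → j ≡ other x₁∈r ⊎ j ≡ other x₂∈r ⊎ j ≡ other x₃∈r
      only j i~j@(_ , t , t∈i , t∈j) with subst (t ∈_) r≡ t∈i
      ... | here refl                 = inj₁ (same-other x₁∈r i~j t∈j)
      ... | there (here refl)         = inj₂ (inj₁ (same-other x₂∈r i~j t∈j))
      ... | there (there (here refl)) = inj₂ (inj₂ (same-other x₃∈r i~j t∈j))

  -- A leaf t and three tiles shared with the three neighbours of its run would be
  -- four distinct tiles in a run of three.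
  cubic⇒no-leaves : Cubic ρ (RunGraph Rs) → ∀ t → t ∈ T → ¬ IsLeaf T t
  cubic⇒no-leaves cubic t _ (r , run , t∈r , only-run) with index-of run t∈r
  ... | i , r~i , t∈i with cubic i
  ... | j₁ , j₂ , j₃ , j₁≢j₂ , j₁≢j₃ , j₂≢j₃ , (i≢j₁ , t₁ , t₁∈i , t₁∈j₁) , (i≢j₂ , t₂ , t₂∈i , t₂∈j₂) ,
        (i≢j₃ , t₃ , t₃∈i , t₃∈j₃) , _ =
    1+n≰n (subst (4 ≤_) (runs-of-three _ (is-run i))
      (Unique-length-≤ ((not-t i≢j₁ t₁∈j₁ ∷ not-t i≢j₂ t₂∈j₂ ∷ not-t i≢j₃ t₃∈j₃ ∷ [])
                       ∷ (different t₁∈i t₁∈j₁ t₂∈j₂ i≢j₁ i≢j₂ j₁≢j₂ ∷ different t₁∈i t₁∈j₁ t₃∈j₃ i≢j₁ i≢j₃ j₁≢j₃ ∷ [])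
                       ∷ (different t₂∈i t₂∈j₂ t₃∈j₃ i≢j₂ i≢j₃ j₂≢j₃ ∷ []) ∷ [] ∷ [])
                       (t∈i ∷ t₁∈i ∷ t₂∈i ∷ t₃∈i ∷ [])))
    where
      not-t : ∀ {j u} → i ≢ j → u ∈ Rs j → t ≢ u
      not-t {j} i≢j t∈j refl = i≢j (sym (index-injective (SameRun-trans (only-run (Rs j) (is-run j) t∈j) r~i)))
      different : ∀ {u v j k} → u ∈ Rs i → u ∈ Rs j → v ∈ Rs k → i ≢ j → i ≢ k → j ≢ k → u ≢ v
      different u∈i u∈j u∈k i≢j i≢k j≢k refl = j≢k (second-run-unique u∈i u∈j u∈k i≢j i≢k)

  no-leaves⇔cubic : (∀ t → t ∈ T → ¬ IsLeaf T t) ⇔ Cubic ρ (RunGraph Rs)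
  no-leaves⇔cubic = mk⇔ no-leaves⇒cubic cubic⇒no-leaves

  runs-through : Tile → List (Fin ρ)
  runs-through t = filter (λ i → t ∈ₗ? Rs i) (allFin ρ)

  ∈-runs-through⁺ : ∀ {t i} → t ∈ Rs i → i ∈ runs-through t
  ∈-runs-through⁺ {t} {i} t∈i = ∈-filter⁺ (λ i → t ∈ₗ? Rs i) (∈-allFin i) t∈i

  ∈-runs-through⁻ : ∀ {t i} → i ∈ runs-through t → t ∈ Rs i
  ∈-runs-through⁻ {t} i∈ = proj₂ (∈-filter⁻ (λ i → t ∈ₗ? Rs i) {xs = allFin ρ} i∈)

  runs-through-one-or-two : ∀ {t} → t ∈ T → OneOrTwo (runs-through t)
  runs-through-one-or-two {t} t∈T =
    let (r , run , t∈r) = in-some-run t∈T ; (_ , _ , t∈i) = index-of run t∈r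
    in one-or-two _ (∈-runs-through⁺ t∈i) (Unique.filter⁺ (λ i → t ∈ₗ? Rs i) (allFin⁺ ρ))
         (λ i∈ j∈ k∈ → three-runs (∈-runs-through⁻ i∈) (∈-runs-through⁻ j∈) (∈-runs-through⁻ k∈))

  module _ {A : Set} where

    pair : List A → List (A × A)
    pair (a ∷ b ∷ _) = (a , b) ∷ []
    pair _           = []

    length-pair : ∀ {l} → OneOrTwo l → suc (length (pair l)) ≡ length l
    length-pair (one _)   = refl
    length-pair (two _ _) = refl

    pair-complete : ∀ {l i j} → OneOrTwo l → i ∈ l → j ∈ l → i ≢ j → (i , j) ∈ pair l ⊎ (j , i) ∈ pair l
    pair-complete (one _)   (here refl)         (here refl)         i≢j = ⊥-elim (i≢j refl)
    pair-complete (two _ _) (here refl)         (here refl)         i≢j = ⊥-elim (i≢j refl)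
    pair-complete (two _ _) (here refl)         (there (here refl)) _   = inj₁ (here refl)
    pair-complete (two _ _) (there (here refl)) (here refl)         _   = inj₂ (here refl)
    pair-complete (two _ _) (there (here refl)) (there (here refl)) i≢j = ⊥-elim (i≢j refl)

    pair-sound : ∀ {l i j} → Unique l → (i , j) ∈ pair l → i ∈ l × j ∈ l × i ≢ j
    pair-sound {_ ∷ _ ∷ _} ((i≢j ∷ _) ∷ _) (here refl) = here refl , there (here refl) , i≢j

    pair-AllPairs : ∀ {R : A × A → A × A → Set} l → AllPairs R (pair l)
    pair-AllPairs []          = []
    pair-AllPairs (_ ∷ [])    = []
    pair-AllPairs (_ ∷ _ ∷ _) = [] ∷ []

  run-graph-edges : List (Fin ρ × Fin ρ)
  run-graph-edges = concatMap (pair ∘ runs-through) T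

  ∈-pair-runs-through : ∀ {t i j} → (i , j) ∈ pair (runs-through t) → t ∈ Rs i × t ∈ Rs j × i ≢ j
  ∈-pair-runs-through {t} ij∈ =
    let (i∈ , j∈ , i≢j) = pair-sound (Unique.filter⁺ (λ i → t ∈ₗ? Rs i) (allFin⁺ ρ)) ij∈
    in ∈-runs-through⁻ i∈ , ∈-runs-through⁻ j∈ , i≢j

  ∈-run-graph-edges : ∀ {i j} → (i , j) ∈ run-graph-edges → ∃[ t ] (t ∈ T × t ∈ Rs i × t ∈ Rs j × i ≢ j)
  ∈-run-graph-edges ij∈ =
    let (t , t∈T , ij∈t) = find (∈-concatMap⁻ (pair ∘ runs-through) {xs = T} ij∈) in t , t∈T , ∈-pair-runs-through ij∈t

  RunGraph⇒Joins : ∀ {i j} → RunGraph Rs i j → Joins run-graph-edges i j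
  RunGraph⇒Joins (i≢j , t , t∈i , t∈j) =
    Data.Sum.map listed listed
      (pair-complete (runs-through-one-or-two t∈T) (∈-runs-through⁺ t∈i) (∈-runs-through⁺ t∈j) i≢j)
    where
      t∈T = ∈Rs⇒∈T t∈i
      listed : ∀ {p} → p ∈ pair (runs-through t) → p ∈ run-graph-edges
      listed p∈ = ∈-concatMap⁺ (pair ∘ runs-through) (Any.map (λ { refl → p∈ }) t∈T)

  Joins⇒RunGraph : ∀ {i j} → Joins run-graph-edges i j → RunGraph Rs i j
  Joins⇒RunGraph (inj₁ ij∈) = let (t , _ , t∈i , t∈j , i≢j) = ∈-run-graph-edges ij∈ in i≢j , t , t∈i , t∈j
  Joins⇒RunGraph (inj₂ ji∈) = let (t , _ , t∈j , t∈i , j≢i) = ∈-run-graph-edges ji∈ in ≢-sym j≢i , t , t∈i , t∈j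

  -- Two tiles giving the same edge would be two common tiles of two distinct runs.
  run-graph-edges-simple : Simple run-graph-edges
  run-graph-edges-simple =
    All.tabulate (λ { {a , b} ab∈ → proj₂ (proj₂ (proj₂ (proj₂ (∈-run-graph-edges ab∈)))) }) ,
    AllPairs-concatMap (pair ∘ runs-through) unique (pair-AllPairs ∘ runs-through) different
    where
      different : ∀ {t t′ p q} → t ≢ t′ → p ∈ pair (runs-through t) → q ∈ pair (runs-through t′) → ¬ SameEdge p q
      different {p = a , b} {c , d} t≢t′ ab∈ cd∈ same
        with ∈-pair-runs-through ab∈ | ∈-pair-runs-through cd∈ | same
      ... | t∈a , t∈b , a≢b | t′∈c , t′∈d , _ | inj₁ (refl , refl) = a≢b (two-common-tiles t≢t′ t∈a t′∈c t∈b t′∈d)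
      ... | t∈a , t∈b , a≢b | t′∈c , t′∈d , _ | inj₂ (refl , refl) = a≢b (two-common-tiles t≢t′ t∈a t′∈d t∈b t′∈c)

  -- Each tile is counted once for every run through it.
  edges+tiles≡3ρ : length run-graph-edges + length T ≡ 3 * ρ
  edges+tiles≡3ρ = begin
    length run-graph-edges + length T
      ≡⟨ cong₂ _+_ (length-concatMap≡∑ (pair ∘ runs-through) T) (sym (trans (∑-const T 1) (*-identityʳ _))) ⟩
    ∑ T (λ t → length (pair (runs-through t))) + ∑ T (λ _ → 1)
      ≡⟨ ∑-distrib-+ T _ _ ⟨
    ∑ T (λ t → length (pair (runs-through t)) + 1)
      ≡⟨ ∑-cong T (λ t t∈T → trans (+-comm _ 1) (length-pair (runs-through-one-or-two t∈T))) ⟩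
    ∑ T (λ t → length (runs-through t))
      ≡⟨ ∑-cong T (λ t _ → length-filter≡∑𝟙 (λ i → t ∈ₗ? Rs i) (allFin ρ)) ⟩
    ∑ T (λ t → ∑ (allFin ρ) (λ i → 𝟙 (t ∈ₗ? Rs i)))
      ≡⟨ ∑-swap T (allFin ρ) _ ⟩
    ∑ (allFin ρ) (λ i → ∑ T (λ t → 𝟙 (t ∈ₗ? Rs i)))
      ≡⟨ ∑-cong (allFin ρ) (λ i _ → trans (∑𝟙-∈? _≟_ unique (run-unique i) (run⊆T i)) (runs-of-three _ (is-run i))) ⟩
    ∑ (allFin ρ) (λ _ → 3)
      ≡⟨ ∑-const (allFin ρ) 3 ⟩
    length (allFin ρ) * 3
      ≡⟨ cong (_* 3) (length-tabulate {n = ρ} (λ i → i)) ⟩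
    ρ * 3
      ≡⟨ *-comm ρ 3 ⟩
    3 * ρ ∎
    where
      open ≡-Reasoning
      run⊆T : ∀ i → All (_∈ T) (Rs i)
      run⊆T i = proj₁ (proj₁ (is-run i))
      run-unique : ∀ i → Unique (Rs i)
      run-unique i = proj₁ (proj₂ (proj₁ (is-run i)))

  tiles⇔edges : ∀ e τ n → e + τ ≡ 3 * n → (τ ≡ 2 * n + 1) ⇔ (suc e ≡ n)
  tiles⇔edges e τ n count = mk⇔
    (λ τ≡ → +-cancelʳ-≡ (2 * n) (suc e) n (trans (shift e n) (trans (cong (e +_) (sym τ≡)) count)))
    (λ e≡ → +-cancelˡ-≡ e τ (2 * n + 1) (trans count (subst (λ m → 3 * m ≡ e + (2 * m + 1)) e≡ (expand e))))
    where
      shift : ∀ e n → suc e + 2 * n ≡ e + (2 * n + 1)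
      shift = solve-∀
      expand : ∀ e → 3 * suc e ≡ e + (2 * suc e + 1)
      expand = solve-∀

  some-run : Fin ρ
  some-run = let (t , t∈T) = first-tile T large ; (r , run , t∈r) = in-some-run t∈T in proj₁ (index-of run t∈r)
    where
      first-tile : ∀ (L : List Tile) → 5 ≤ length L → ∃[ t ] (t ∈ L)
      first-tile (t ∷ _) _ = t , here refl

  tiles≡2ρ+1⇔tree : (length T ≡ 2 * ρ + 1) ⇔ IsTree ρ (RunGraph Rs)
  tiles≡2ρ+1⇔tree = mk⇔
    (λ τ≡ → run-graph-connected , Equivalence.from acyclic⇔ (Equivalence.to count⇔ τ≡))
    (λ (_ , acyclic) → Equivalence.from count⇔ (Equivalence.to acyclic⇔ acyclic))
    where
      count⇔ = tiles⇔edges _ _ ρ edges+tiles≡3ρ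
      acyclic⇔ = acyclic⇔suc-length≡n RunGraph⇒Joins Joins⇒RunGraph run-graph-edges-simple run-graph-connected some-run

corollary3 : (T : List Tile) → Tredoku T →
    (ρ : ℕ) (Rs : Fin ρ → List Tile) → RunEnumeration T ρ Rs →
    ((∀ t → t ∈ T → ¬ IsLeaf T t) ⇔ Cubic ρ (RunGraph Rs))
    × ((length T ≡ 2 * ρ + 1) ⇔ IsTree ρ (RunGraph Rs))
corollary3 T tredoku ρ Rs enumeration =
  RunGraphs.no-leaves⇔cubic T tredoku ρ Rs enumeration , RunGraphs.tiles≡2ρ+1⇔tree T tredoku ρ Rs enumeration
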